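{- Let $\mathcal C_n$ be the set of permutations in $\mathfrak S_n$ avoiding each of $2\text{ - }1\text{ - }3$, $2\text{ - }3\text{ - }4\text{ - }1$... more precisely avoiding the generalized patterns $2\text{ - }1\text{ - }3$, $2\text{ - }3\text{ - }41$ and $3\text{ - }2\text{ - }41$, and let $K(t,u)=\sum_{n\ge1}\sum_{\pi\in\mathcal C_n}u^{\pi_n}t^n$. Then $$K(t,u)=\frac{1-t-2tu-\sqrt{1-2t-3t^2}}{2t\left(\frac1u+1+u\right)-2}.$$
   Context: $\mathfrak S_n$ is the set of permutations $\pi=\pi_1\cdots\pi_n$ of $\{1,\dots,n\}$. A generalized pattern is a permutation $\sigma_1\cdots\sigma_k$ with dashes possibly inserted between consecutive letters; $\pi$ contains it if there are indices $i_1<\dots<i_k$ such that $i_{j+1}=i_j+1$ whenever there is no dash between $\sigma_j$ and $\sigma_{j+1}$, and $\pi_{i_a}<\pi_{i_b}$ iff $\sigma_a<\sigma_b$; otherwise $\pi$ avoids it. Thus avoiding $2\text{ - }3\text{ - }41$ means there are no $i<j<k$ with $\pi_{k+1}<\pi_i<\pi_j<\pi_k$, and avoiding $3\text{ - }2\text{ - }41$ means there are no $i<j<k$ with $\pi_{k+1}<\pi_j<\pi_i<\pi_k$. $K$ is a formal power series in $t$. -}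

module Defs where

open import Data.Nat using (ℕ; zero; suc; _≡ᵇ_; _<ᵇ_)
open import Data.Bool using (Bool; true; false; _∧_; _∨_; not; if_then_else_)
open import Data.List using (List; []; _∷_; map; concatMap; length; filter; foldr; upTo; last)
open import Data.Bool.ListAction using (any; all)
open import Data.Maybe using (Maybe; just; nothing)
open import Data.Integer using (ℤ; +_; -_; _+_; _*_; 0ℤ; 1ℤ)
import Data.Nat as N
open import Relation.Binary.PropositionalEquality using (_≡_)
open import Relation.Nullary.Decidable using (⌊_⌋)
open import Data.Bool using (T)
import Data.Nat.Properties as NP

-- A word is a list of naturals; position i (0-indexed) holds π_{i+1}.
-- Out-of-range lookups return 0 (never used below).
at : List ℕ → ℕ → ℕ
at []       _       = 0
at (x ∷ _)  zero    = x
at (_ ∷ xs) (suc i) = at xs i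

oneTo : ℕ → List ℕ
oneTo m = map suc (upTo m)

words : ℕ → ℕ → List (List ℕ)
words zero    m = [] ∷ []
words (suc l) m = concatMap (λ x → map (x ∷_) (words l m)) (oneTo m)

anyBelow : ℕ → (ℕ → Bool) → Bool
anyBelow n p = any p (upTo n)

allBelow : ℕ → (ℕ → Bool) → Bool
allBelow n p = all p (upTo n)

-- a word of length n with letters in {1..n} is a permutation of {1..n}
-- iff its letters are pairwise distinct
distinct : ℕ → List ℕ → Bool
distinct n w = allBelow n λ i → allBelow n λ j →
  not (i <ᵇ j) ∨ not (at w i ≡ᵇ at w j)

contains213 : ℕ → List ℕ → Bool
contains213 n w = anyBelow n λ i → anyBelow n λ j → anyBelow n λ k →
  (i <ᵇ j) ∧ (j <ᵇ k) ∧ (at w j <ᵇ at w i) ∧ (at w i <ᵇ at w k)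

contains2341 : ℕ → List ℕ → Bool
contains2341 n w = anyBelow n λ i → anyBelow n λ j → anyBelow n λ k →
  (i <ᵇ j) ∧ (j <ᵇ k) ∧ (suc k <ᵇ n) ∧
  (at w (suc k) <ᵇ at w i) ∧ (at w i <ᵇ at w j) ∧ (at w j <ᵇ at w k)

contains3241 : ℕ → List ℕ → Bool
contains3241 n w = anyBelow n λ i → anyBelow n λ j → anyBelow n λ k →
  (i <ᵇ j) ∧ (j <ᵇ k) ∧ (suc k <ᵇ n) ∧
  (at w (suc k) <ᵇ at w j) ∧ (at w j <ᵇ at w i) ∧ (at w i <ᵇ at w k)

inC : ℕ → List ℕ → Bool
inC n w = distinct n w ∧ not (contains213 n w) ∧ not (contains2341 n w)
          ∧ not (contains3241 n w)

lastIs : ℕ → List ℕ → Bool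
lastIs j w with last w
... | just x  = x ≡ᵇ j
... | nothing = false

countC : ℕ → ℕ → ℕ
countC n j = length (filter (λ w → T? (inC n w ∧ lastIs j w)) (words n n))
  where
  open import Relation.Nullary using (Dec; yes; no)
  T? : (b : Bool) → Dec (T b)
  T? true  = yes _
  T? false = no (λ ())

Σ≤ : ℕ → (ℕ → ℤ) → ℤ
Σ≤ zero    f = f 0
Σ≤ (suc n) f = Σ≤ n f + f (suc n)

Ser₁ : Set
Ser₁ = ℕ → ℤ

-- power series in t with polynomial coefficients in u:
-- F n k = coefficient of t^n u^k
Ser₂ : Set
Ser₂ = ℕ → ℕ → ℤ

_*₁_ : Ser₁ → Ser₁ → Ser₁
(A *₁ B) n = Σ≤ n λ a → A a * B (n N.∸ a)

_*₂_ : Ser₂ → Ser₂ → Ser₂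
(A *₂ B) n k = Σ≤ n λ a → Σ≤ k λ b → A a b * B (n N.∸ a) (k N.∸ b)

K : Ser₂
K zero    k = 0ℤ
K (suc n) k = + countC (suc n) k

disc : Ser₁
disc 0 = 1ℤ
disc 1 = - (+ 2)
disc 2 = - (+ 3)
disc _ = 0ℤ

-- u · (2t(1/u + 1 + u) - 2) = 2t + 2tu + 2tu² - 2u
Du : Ser₂
Du 0 1 = - (+ 2)
Du 1 0 = + 2
Du 1 1 = + 2
Du 1 2 = + 2
Du _ _ = 0ℤ

-- u · (1 - t - 2tu - S(t)),  S a power series in t
Nu : Ser₁ → Ser₂
Nu S n 1 = (δ n 0 + - δ n 1) + - S n
  where
  δ : ℕ → ℕ → ℤ
  δ a b = if a ≡ᵇ b then 1ℤ else 0ℤ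
Nu S 1 2 = - (+ 2)
Nu S _ _ = 0ℤ

module Submission where

-- Write c(n,j) for the number of π ∈ 𝒞ₙ with πₙ = j.  Deleting the
-- last letter j ≥ 1 of π ∈ 𝒞_{n+1} and standardising is a bijection onto the words of
-- 𝒞ₙ ending in j - 1, j or j + 1, so c(n+1,j) = c(n,j-1) + c(n,j) + c(n,j+1).
--
-- In u-degree ≠ 1 the identity K·Du = Nu S is this recurrence together with
-- the first values of K; in u-degree 1 it says that the numbers 𝕄ₘ = c(m+1,1) give the
-- coefficients of S = 1 - t - 2t²𝕄.  The recurrence yields the Motzkin recurrence for 𝕄
-- (Motzkin), hence (1 - t - 2t²𝕄)² = 1 - 2t - 3t², and a series with constant term 1 is
-- determined by its square (SquareRoot).

module Counting where

  open import Data.Nat using (suc; _+_; _≤_; z≤n; s≤s)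
  open import Data.Nat.Properties using (≤-antisym; +-suc)
  open import Data.Product using (_×_; _,_; proj₂)
  open import Data.List using (List; []; _∷_; _++_; map; length; filter)
  open import Data.List.Properties using (length-map; length-++)
  open import Data.List.Membership.Propositional using (_∈_)
  open import Data.List.Membership.Propositional.Properties
    using (∈-∃++; ∈-++⁻; ∈-++⁺ˡ; ∈-++⁺ʳ; ∈-map⁻; ∈-filter⁻; ∈-filter⁺)
  open import Data.List.Relation.Unary.Any using (here; there)
  open import Data.List.Relation.Unary.All as All using (All; []; _∷_)
  open import Data.List.Relation.Unary.AllPairs using ([]; _∷_)
  open import Data.List.Relation.Unary.Unique.Propositional using (Unique)
  import Data.List.Relation.Unary.Unique.Propositional.Properties as Unique
  open import Data.Empty using (⊥-elim)
  open import Data.Sum using (inj₁; inj₂)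
  open import Relation.Nullary using (¬_; yes; no; _⊎-dec_)
  open import Relation.Unary using (Decidable)
  open import Relation.Binary.PropositionalEquality using (_≡_; refl; sym; trans; cong; subst)

  unique-⊆⇒length≤ : {A : Set} (xs ys : List A) → Unique xs → (∀ {x} → x ∈ xs → x ∈ ys) →
    length xs ≤ length ys
  unique-⊆⇒length≤ [] ys _ _ = z≤n
  unique-⊆⇒length≤ (x ∷ xs) ys (x∉xs ∷ xs!) xs⊆ys with ∈-∃++ (xs⊆ys (here refl))
  ... | ys₁ , ys₂ , refl =
    subst (suc (length xs) ≤_) (sym length-split)
      (s≤s (unique-⊆⇒length≤ xs (ys₁ ++ ys₂) xs! xs⊆ys₁++ys₂))
    where
    length-split : length (ys₁ ++ x ∷ ys₂) ≡ suc (length (ys₁ ++ ys₂))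
    length-split = trans (length-++ ys₁)
      (trans (+-suc (length ys₁) (length ys₂)) (cong suc (sym (length-++ ys₁))))
    -- x itself is not in xs, so xs fits into ys with x removed
    xs⊆ys₁++ys₂ : ∀ {z} → z ∈ xs → z ∈ ys₁ ++ ys₂
    xs⊆ys₁++ys₂ z∈xs with ∈-++⁻ ys₁ (xs⊆ys (there z∈xs))
    ... | inj₁ z∈ys₁         = ∈-++⁺ˡ z∈ys₁
    ... | inj₂ (here refl)   = ⊥-elim (All.lookup x∉xs z∈xs refl)
    ... | inj₂ (there z∈ys₂) = ∈-++⁺ʳ ys₁ z∈ys₂

  unique-map : {A B : Set} (f : A → B) (xs : List A) →
    (∀ {a b} → a ∈ xs → b ∈ xs → f a ≡ f b → a ≡ b) → Unique xs → Unique (map f xs)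
  unique-map f [] _ [] = []
  unique-map f (x ∷ xs) f-inj (x∉xs ∷ xs!) =
    image-avoids xs there x∉xs ∷ unique-map f xs (λ a b → f-inj (there a) (there b)) xs!
    where
    image-avoids : (ws : List _) → (∀ {w} → w ∈ ws → w ∈ x ∷ xs) →
      All (λ w → ¬ x ≡ w) ws → All (λ v → ¬ f x ≡ v) (map f ws)
    image-avoids [] _ [] = []
    image-avoids (w ∷ ws) ws⊆ (x≢w ∷ x∉ws) =
      (λ fx≡fw → x≢w (f-inj (here refl) (ws⊆ (here refl)) fx≡fw))
      ∷ image-avoids ws (λ m → ws⊆ (there m)) x∉ws

  module _ {A B : Set} {P : A → Set} {Q : B → Set} (P? : Decidable P) (Q? : Decidable Q) where

    count-≤ : {xs : List A} {ys : List B} → Unique xs → (f : A → B) (g : B → A) →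
      (∀ {x} → x ∈ xs → P x → (f x ∈ ys × Q (f x)) × g (f x) ≡ x) →
      length (filter P? xs) ≤ length (filter Q? ys)
    count-≤ {xs} {ys} xs! f g f-into =
      subst (_≤ length (filter Q? ys)) (length-map f (filter P? xs))
        (unique-⊆⇒length≤ (map f (filter P? xs)) (filter Q? ys)
          (unique-map f (filter P? xs) f-injective (Unique.filter⁺ P? xs!)) image⊆)
      where
      f-injective : ∀ {a b} → a ∈ filter P? xs → b ∈ filter P? xs → f a ≡ f b → a ≡ b
      f-injective a∈ b∈ fa≡fb =
        let (a∈xs , Pa) = ∈-filter⁻ P? a∈ ; (b∈xs , Pb) = ∈-filter⁻ P? b∈ in
        trans (sym (proj₂ (f-into a∈xs Pa))) (trans (cong g fa≡fb) (proj₂ (f-into b∈xs Pb)))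
      image⊆ : ∀ {y} → y ∈ map f (filter P? xs) → y ∈ filter Q? ys
      image⊆ y∈ with ∈-map⁻ f y∈
      ... | a , a∈ , refl =
        let (a∈xs , Pa) = ∈-filter⁻ P? a∈ ; ((fa∈ys , Qfa) , _) = f-into a∈xs Pa in
        ∈-filter⁺ Q? fa∈ys Qfa

  count-≡ : {A B : Set} {P : A → Set} {Q : B → Set} (P? : Decidable P) (Q? : Decidable Q)
    {xs : List A} {ys : List B} → Unique xs → Unique ys → (f : A → B) (g : B → A) →
    (∀ {x} → x ∈ xs → P x → (f x ∈ ys × Q (f x)) × g (f x) ≡ x) →
    (∀ {y} → y ∈ ys → Q y → (g y ∈ xs × P (g y)) × f (g y) ≡ y) →
    length (filter P? xs) ≡ length (filter Q? ys)
  count-≡ P? Q? xs! ys! f g f-into g-into =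
    ≤-antisym (count-≤ P? Q? xs! f g f-into) (count-≤ Q? P? ys! g f g-into)

  count-⊎ : {A : Set} {P Q : A → Set} (P? : Decidable P) (Q? : Decidable Q) →
    (∀ x → ¬ (P x × Q x)) → ∀ xs →
    length (filter (λ x → P? x ⊎-dec Q? x) xs) ≡ length (filter P? xs) + length (filter Q? xs)
  count-⊎ P? Q? disjoint [] = refl
  count-⊎ P? Q? disjoint (x ∷ xs) with P? x | Q? x
  ... | yes Px | yes Qx = ⊥-elim (disjoint x (Px , Qx))
  ... | yes _  | no _   = cong suc (count-⊎ P? Q? disjoint xs)
  ... | no _   | yes _  = trans (cong suc (count-⊎ P? Q? disjoint xs))
    (sym (+-suc (length (filter P? xs)) (length (filter Q? xs))))
  ... | no _   | no _   = count-⊎ P? Q? disjoint xs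

module Words where

  open import Data.Nat using (ℕ; zero; suc; _≤_; _<_; z≤n; s≤s)
  open import Data.Nat.Properties using (suc-injective)
  open import Data.Product using (Σ; _×_; _,_)
  open import Data.Sum using (inj₁; inj₂)
  open import Data.List using (List; []; _∷_; map; length; upTo; concatMap)
  open import Data.List.Properties using (length-map; length-upTo)
  open import Data.List.Membership.Propositional using (_∈_)
  open import Data.List.Membership.Propositional.Properties
    using (∈-++⁻; ∈-++⁺ˡ; ∈-++⁺ʳ; ∈-map⁺; ∈-map⁻; ∈-upTo⁺; ∈-applyUpTo⁻)
  open import Data.List.Relation.Unary.Any using (here; there)
  open import Data.List.Relation.Unary.All as All using (All; []; _∷_)
  open import Data.List.Relation.Unary.AllPairs using ([]; _∷_)
  open import Data.List.Relation.Unary.Unique.Propositional using (Unique)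
  import Data.List.Relation.Unary.Unique.Propositional.Properties as Unique
  open import Relation.Binary.PropositionalEquality using (_≡_; refl; trans; cong)
  open import Relation.Nullary using (¬_)
  open import Function using (id)
  open import Defs using (oneTo; words)

  ∈-oneTo⁺ : ∀ {m y} → 0 < y → y ≤ m → y ∈ oneTo m
  ∈-oneTo⁺ {y = suc y} _ y≤m = ∈-map⁺ suc (∈-upTo⁺ y≤m)

  ∈-oneTo⁻ : ∀ {m y} → y ∈ oneTo m → 0 < y × y ≤ m
  ∈-oneTo⁻ y∈ with ∈-map⁻ suc y∈
  ... | x , x∈ , refl with ∈-applyUpTo⁻ id x∈
  ... | i , i<m , refl = s≤s z≤n , i<m

  length-oneTo : ∀ m → length (oneTo m) ≡ m
  length-oneTo m = trans (length-map suc (upTo m)) (length-upTo m)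

  unique-oneTo : ∀ m → Unique (oneTo m)
  unique-oneTo m = Unique.map⁺ suc-injective (Unique.upTo⁺ m)

  module Prefixing (W : List (List ℕ)) where

    prefixAll : List ℕ → List (List ℕ)
    prefixAll = concatMap (λ x → map (x ∷_) W)

    ∈-prefixAll⁺ : ∀ {x xs w} → x ∈ xs → w ∈ W → (x ∷ w) ∈ prefixAll xs
    ∈-prefixAll⁺ {xs = y ∷ xs} (here refl) w∈ = ∈-++⁺ˡ (∈-map⁺ (y ∷_) w∈)
    ∈-prefixAll⁺ {xs = y ∷ xs} (there x∈) w∈ = ∈-++⁺ʳ (map (y ∷_) W) (∈-prefixAll⁺ x∈ w∈)

    ∈-prefixAll⁻ : ∀ {xs v} → v ∈ prefixAll xs →
      Σ ℕ λ x → Σ (List ℕ) λ w → x ∈ xs × w ∈ W × v ≡ x ∷ w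
    ∈-prefixAll⁻ {y ∷ xs} v∈ with ∈-++⁻ (map (y ∷_) W) v∈
    ... | inj₁ v∈yW with ∈-map⁻ (y ∷_) v∈yW
    ...   | w , w∈ , refl = y , w , here refl , w∈ , refl
    ∈-prefixAll⁻ {y ∷ xs} v∈ | inj₂ v∈rest with ∈-prefixAll⁻ {xs} v∈rest
    ...   | x , w , x∈ , w∈ , refl = x , w , there x∈ , w∈ , refl

    unique-prefixAll : ∀ xs → Unique xs → Unique W → Unique (prefixAll xs)
    unique-prefixAll [] _ _ = []
    unique-prefixAll (y ∷ xs) (y∉xs ∷ xs!) W! =
      Unique.++⁺ (Unique.map⁺ (λ { refl → refl }) W!) (unique-prefixAll xs xs! W!) disjoint
      where
      disjoint : ∀ {v} → ¬ (v ∈ map (y ∷_) W × v ∈ prefixAll xs)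
      disjoint (v∈yW , v∈rest) with ∈-map⁻ (y ∷_) v∈yW | ∈-prefixAll⁻ {xs} v∈rest
      ... | _ , _ , refl | _ , _ , y∈xs , _ , refl = All.lookup y∉xs y∈xs refl

  open Prefixing

  words-length : ∀ {l m w} → w ∈ words l m → length w ≡ l
  words-length {zero} (here refl) = refl
  words-length {suc l} {m} w∈ with ∈-prefixAll⁻ (words l m) {oneTo m} w∈
  ... | _ , _ , _ , w∈' , refl = cong suc (words-length {l} w∈')

  words-letters : ∀ {l m w} → w ∈ words l m → All (_∈ oneTo m) w
  words-letters {zero} (here refl) = []
  words-letters {suc l} {m} w∈ with ∈-prefixAll⁻ (words l m) {oneTo m} w∈
  ... | _ , _ , x∈ , w∈' , refl = x∈ ∷ words-letters {l} w∈'

  words-complete : ∀ {m} w → All (_∈ oneTo m) w → w ∈ words (length w) m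
  words-complete [] [] = here refl
  words-complete {m} (x ∷ w) (x∈ ∷ w∈) = ∈-prefixAll⁺ (words (length w) m) x∈ (words-complete w w∈)

  words-unique : ∀ l m → Unique (words l m)
  words-unique zero m = [] ∷ []
  words-unique (suc l) m = unique-prefixAll (words l m) (oneTo m) (unique-oneTo m) (words-unique l m)

module Patterns where

  open import Data.Nat using (ℕ; zero; suc; _<_; z<s; s<s; _≡ᵇ_; _<ᵇ_)
  open import Data.Nat.Properties using (<-trans; n<1+n; <ᵇ⇒<; <⇒<ᵇ; ≡ᵇ⇒≡; ≡⇒≡ᵇ)
  open import Data.Bool using (Bool; true; false; T; _∧_; _∨_; not)
  open import Data.Bool.Properties using (T-∧; T-∨)
  open import Data.Bool.ListAction using (any; all)
  open import Data.List using (List; applyUpTo)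
  open import Data.Product using (Σ; ∃; _×_; _,_; proj₁; proj₂)
  open import Data.Sum using (inj₁; inj₂)
  open import Function using (id; _∘_)
  open import Function.Bundles using (Equivalence)
  open import Relation.Binary.PropositionalEquality using (_≡_; sym; subst)
  open import Relation.Nullary using (¬_)
  open import Defs

  ∧⁻ : ∀ {a b} → T (a ∧ b) → T a × T b
  ∧⁻ {a} = Equivalence.to (T-∧ {a})

  ∧⁺ : ∀ {a b} → T a → T b → T (a ∧ b)
  ∧⁺ ta tb = Equivalence.from T-∧ (ta , tb)

  not⁺ : ∀ {b} → ¬ T b → T (not b)
  not⁺ {true} ¬tb = ¬tb _
  not⁺ {false} _ = _

  not⁻ : ∀ {b} → T (not b) → ¬ T b
  not⁻ {true} ()

  <ᵇ∧⁻ : ∀ a b {r} → T ((a <ᵇ b) ∧ r) → a < b × T r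
  <ᵇ∧⁻ a b t = let (a<b , tr) = ∧⁻ {a <ᵇ b} t in <ᵇ⇒< a b a<b , tr

  <ᵇ∧⁺ : ∀ {a b r} → a < b → T r → T ((a <ᵇ b) ∧ r)
  <ᵇ∧⁺ a<b tr = ∧⁺ (<⇒<ᵇ a<b) tr

  any⁻ : ∀ (f : ℕ → ℕ) n (p : ℕ → Bool) → T (any p (applyUpTo f n)) → ∃ λ i → i < n × T (p (f i))
  any⁻ f (suc n) p t with p (f 0) in pf0
  ... | true = 0 , z<s , subst T (sym pf0) _
  ... | false with any⁻ (f ∘ suc) n p t
  ...   | i , i<n , pi = suc i , s<s i<n , pi

  any⁺ : ∀ (f : ℕ → ℕ) n (p : ℕ → Bool) i → i < n → T (p (f i)) → T (any p (applyUpTo f n))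
  any⁺ f (suc n) p zero _ t = Equivalence.from T-∨ (inj₁ t)
  any⁺ f (suc n) p (suc i) (s<s i<n) t =
    Equivalence.from (T-∨ {p (f 0)}) (inj₂ (any⁺ (f ∘ suc) n p i i<n t))

  all⁻ : ∀ (f : ℕ → ℕ) n (p : ℕ → Bool) → T (all p (applyUpTo f n)) → ∀ i → i < n → T (p (f i))
  all⁻ f (suc n) p t zero _ = proj₁ (∧⁻ t)
  all⁻ f (suc n) p t (suc i) (s<s i<n) = all⁻ (f ∘ suc) n p (proj₂ (∧⁻ {p (f 0)} t)) i i<n

  all⁺ : ∀ (f : ℕ → ℕ) n (p : ℕ → Bool) → (∀ i → i < n → T (p (f i))) → T (all p (applyUpTo f n))
  all⁺ f zero p _ = _
  all⁺ f (suc n) p h = ∧⁺ (h 0 z<s) (all⁺ (f ∘ suc) n p (λ i i<n → h (suc i) (s<s i<n)))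

  any³⁻ : ∀ n (q : ℕ → ℕ → ℕ → Bool) →
    T (anyBelow n λ i → anyBelow n λ j → anyBelow n λ k → q i j k) →
    Σ ℕ λ i → Σ ℕ λ j → Σ ℕ λ k → k < n × T (q i j k)
  any³⁻ n q t with any⁻ id n (λ i → anyBelow n λ j → anyBelow n λ k → q i j k) t
  ... | i , _ , tᵢ with any⁻ id n (λ j → anyBelow n λ k → q i j k) tᵢ
  ... | j , _ , tⱼ with any⁻ id n (λ k → q i j k) tⱼ
  ... | k , k<n , tₖ = i , j , k , k<n , tₖ

  any³⁺ : ∀ n (q : ℕ → ℕ → ℕ → Bool) i j k → i < n → j < n → k < n → T (q i j k) →
    T (anyBelow n λ i → anyBelow n λ j → anyBelow n λ k → q i j k)
  any³⁺ n q i j k i<n j<n k<n t =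
    any⁺ id n (λ i → anyBelow n λ j → anyBelow n λ k → q i j k) i i<n
      (any⁺ id n (λ j → anyBelow n λ k → q i j k) j j<n (any⁺ id n (λ k → q i j k) k k<n t))

  bounds : ∀ {i j k n} → i < j → j < k → k < n → i < n × j < n
  bounds i<j j<k k<n = <-trans i<j (<-trans j<k k<n) , <-trans j<k k<n

  bounds⁴¹ : ∀ {i j k n} → i < j → j < k → suc k < n → i < n × j < n × k < n
  bounds⁴¹ {k = k} i<j j<k k+1<n =
    let k<n = <-trans (n<1+n k) k+1<n ; (i<n , j<n) = bounds i<j j<k k<n in i<n , j<n , k<n

  Distinct : ℕ → List ℕ → Set
  Distinct n w = ∀ {i j} → i < j → j < n → ¬ at w i ≡ at w j

  data Has213 (n : ℕ) (w : List ℕ) : Set where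
    has213 : ∀ {i j k} → i < j → j < k → k < n →
      at w j < at w i → at w i < at w k → Has213 n w

  data Has2341 (n : ℕ) (w : List ℕ) : Set where
    has2341 : ∀ {i j k} → i < j → j < k → suc k < n →
      at w (suc k) < at w i → at w i < at w j → at w j < at w k → Has2341 n w

  data Has3241 (n : ℕ) (w : List ℕ) : Set where
    has3241 : ∀ {i j k} → i < j → j < k → suc k < n →
      at w (suc k) < at w j → at w j < at w i → at w i < at w k → Has3241 n w

  record In𝒞 (n : ℕ) (w : List ℕ) : Set where
    constructor mkIn𝒞
    field
      distinctLetters : Distinct n w
      avoids213 : ¬ Has213 n w
      avoids2341 : ¬ Has2341 n w
      avoids3241 : ¬ Has3241 n w

  decodeDistinct : ∀ n w → T (distinct n w) → Distinct n w
  decodeDistinct n w t {i} {j} i<j j<n wi≡wj with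
    Equivalence.to (T-∨ {not (i <ᵇ j)}) (all⁻ id n _ (all⁻ id n _ t i (<-trans i<j j<n)) j j<n)
  ... | inj₁ i≮j = not⁻ i≮j (<⇒<ᵇ i<j)
  ... | inj₂ wi≢wj = not⁻ wi≢wj (≡⇒≡ᵇ _ _ wi≡wj)

  encodeDistinct : ∀ n w → Distinct n w → T (distinct n w)
  encodeDistinct n w d = all⁺ id n _ λ i _ → all⁺ id n _ λ j j<n → pair i j j<n
    where
    pair : ∀ i j → j < n → T (not (i <ᵇ j) ∨ not (at w i ≡ᵇ at w j))
    pair i j j<n with i <ᵇ j in i<ᵇj
    ... | false = _
    ... | true = not⁺ λ t → d (<ᵇ⇒< i j (subst T (sym i<ᵇj) _)) j<n (≡ᵇ⇒≡ _ _ t)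

  decode213 : ∀ n w → T (contains213 n w) → Has213 n w
  decode213 n w t with any³⁻ n _ t
  ... | i , j , k , k<n , t₀ =
    let (i<j , t₁) = <ᵇ∧⁻ i j t₀ ; (j<k , t₂) = <ᵇ∧⁻ j k t₁
        (wj<wi , t₃) = <ᵇ∧⁻ (at w j) (at w i) t₂
    in has213 i<j j<k k<n wj<wi (<ᵇ⇒< _ _ t₃)

  encode213 : ∀ n w → Has213 n w → T (contains213 n w)
  encode213 n w (has213 {i} {j} {k} i<j j<k k<n wj<wi wi<wk) =
    let (i<n , j<n) = bounds i<j j<k k<n in
    any³⁺ n _ i j k i<n j<n k<n (<ᵇ∧⁺ i<j (<ᵇ∧⁺ j<k (<ᵇ∧⁺ wj<wi (<⇒<ᵇ wi<wk))))

  decode2341 : ∀ n w → T (contains2341 n w) → Has2341 n w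
  decode2341 n w t with any³⁻ n _ t
  ... | i , j , k , _ , t₀ =
    let (i<j , t₁) = <ᵇ∧⁻ i j t₀ ; (j<k , t₂) = <ᵇ∧⁻ j k t₁ ; (k+1<n , t₃) = <ᵇ∧⁻ (suc k) n t₂
        (a , t₄) = <ᵇ∧⁻ (at w (suc k)) (at w i) t₃ ; (b , t₅) = <ᵇ∧⁻ (at w i) (at w j) t₄
    in has2341 i<j j<k k+1<n a b (<ᵇ⇒< _ _ t₅)

  encode2341 : ∀ n w → Has2341 n w → T (contains2341 n w)
  encode2341 n w (has2341 {i} {j} {k} i<j j<k k+1<n a b c) =
    let (i<n , j<n , k<n) = bounds⁴¹ i<j j<k k+1<n in
    any³⁺ n _ i j k i<n j<n k<n (<ᵇ∧⁺ i<j (<ᵇ∧⁺ j<k (<ᵇ∧⁺ k+1<n (<ᵇ∧⁺ a (<ᵇ∧⁺ b (<⇒<ᵇ c))))))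

  decode3241 : ∀ n w → T (contains3241 n w) → Has3241 n w
  decode3241 n w t with any³⁻ n _ t
  ... | i , j , k , _ , t₀ =
    let (i<j , t₁) = <ᵇ∧⁻ i j t₀ ; (j<k , t₂) = <ᵇ∧⁻ j k t₁ ; (k+1<n , t₃) = <ᵇ∧⁻ (suc k) n t₂
        (a , t₄) = <ᵇ∧⁻ (at w (suc k)) (at w j) t₃ ; (b , t₅) = <ᵇ∧⁻ (at w j) (at w i) t₄
    in has3241 i<j j<k k+1<n a b (<ᵇ⇒< _ _ t₅)

  encode3241 : ∀ n w → Has3241 n w → T (contains3241 n w)
  encode3241 n w (has3241 {i} {j} {k} i<j j<k k+1<n a b c) =
    let (i<n , j<n , k<n) = bounds⁴¹ i<j j<k k+1<n in
    any³⁺ n _ i j k i<n j<n k<n (<ᵇ∧⁺ i<j (<ᵇ∧⁺ j<k (<ᵇ∧⁺ k+1<n (<ᵇ∧⁺ a (<ᵇ∧⁺ b (<⇒<ᵇ c))))))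

  decode𝒞 : ∀ n w → T (inC n w) → In𝒞 n w
  decode𝒞 n w t =
    let (d , t₁) = ∧⁻ {distinct n w} t ; (a , t₂) = ∧⁻ {not (contains213 n w)} t₁
        (b , c) = ∧⁻ {not (contains2341 n w)} t₂
    in mkIn𝒞 (decodeDistinct n w d) (not⁻ a ∘ encode213 n w)
         (not⁻ b ∘ encode2341 n w) (not⁻ c ∘ encode3241 n w)

  encode𝒞 : ∀ n w → In𝒞 n w → T (inC n w)
  encode𝒞 n w (mkIn𝒞 d a b c) =
    ∧⁺ (encodeDistinct n w d) (∧⁺ (not⁺ (a ∘ decode213 n w))
      (∧⁺ (not⁺ (b ∘ decode2341 n w)) (not⁺ (c ∘ decode3241 n w))))

module WordOps where

  open import Data.Nat using (ℕ; zero; suc; pred; _≤_; _<_; s≤s; z<s; s<s; _≡ᵇ_; _<ᵇ_)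
  open import Data.Nat.Properties
  open import Data.Bool using (true; false; T; if_then_else_)
  open import Data.Empty using (⊥-elim)
  open import Data.Product using (Σ; _×_; _,_)
  open import Data.Maybe using (just)
  open import Data.List using (List; []; _∷_; _++_; map; length; last; [_])
  open import Data.List.Properties using (length-++)
  open import Data.List.Membership.Propositional using (_∈_)
  open import Data.List.Relation.Unary.Any using (here; there)
  open import Relation.Binary.PropositionalEquality using (_≡_; refl; sym; trans; cong; subst)
  open import Relation.Binary.Definitions using (tri<; tri≈; tri>)
  open import Relation.Nullary using (¬_)
  open import Defs using (at; lastIs)

  at-map : ∀ (g : ℕ → ℕ) w {i} → i < length w → at (map g w) i ≡ g (at w i)
  at-map g (x ∷ w) {zero} _ = refl
  at-map g (x ∷ w) {suc i} (s<s i<) = at-map g w i<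

  at-∷ʳ-init : ∀ ρ x {i} → i < length ρ → at (ρ ++ [ x ]) i ≡ at ρ i
  at-∷ʳ-init (y ∷ ρ) x {zero} _ = refl
  at-∷ʳ-init (y ∷ ρ) x {suc i} (s<s i<) = at-∷ʳ-init ρ x i<

  at-∷ʳ-last : ∀ ρ x → at (ρ ++ [ x ]) (length ρ) ≡ x
  at-∷ʳ-last [] x = refl
  at-∷ʳ-last (y ∷ ρ) x = at-∷ʳ-last ρ x

  length-∷ʳ : ∀ (ρ : List ℕ) x → length (ρ ++ [ x ]) ≡ suc (length ρ)
  length-∷ʳ ρ x = trans (length-++ ρ) (+-comm (length ρ) 1)

  at-∈ : ∀ w {i} → i < length w → at w i ∈ w
  at-∈ (x ∷ w) {zero} _ = here refl
  at-∈ (x ∷ w) {suc i} (s<s i<) = there (at-∈ w i<)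

  ∈⇒at : ∀ {w y} → y ∈ w → Σ ℕ λ i → i < length w × at w i ≡ y
  ∈⇒at (here refl) = 0 , z<s , refl
  ∈⇒at (there y∈) with ∈⇒at y∈
  ... | i , i< , wi≡y = suc i , s<s i< , wi≡y

  ∷ʳ-view : ∀ n π → length π ≡ suc n → Σ (List ℕ) λ ρ → Σ ℕ λ x → π ≡ ρ ++ [ x ] × length ρ ≡ n
  ∷ʳ-view zero (x ∷ []) _ = [] , x , refl , refl
  ∷ʳ-view (suc n) (y ∷ π) len with ∷ʳ-view n π (suc-injective len)
  ... | ρ , x , refl , lenρ = y ∷ ρ , x , refl , cong suc lenρ

  dropLast : List ℕ → List ℕ
  dropLast [] = []
  dropLast (x ∷ []) = []
  dropLast (x ∷ y ∷ w) = x ∷ dropLast (y ∷ w)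

  lastLetter : List ℕ → ℕ
  lastLetter [] = 0
  lastLetter (x ∷ []) = x
  lastLetter (x ∷ y ∷ w) = lastLetter (y ∷ w)

  dropLast-∷ʳ : ∀ ρ x → dropLast (ρ ++ [ x ]) ≡ ρ
  dropLast-∷ʳ [] x = refl
  dropLast-∷ʳ (y ∷ []) x = refl
  dropLast-∷ʳ (y ∷ z ∷ ρ) x = cong (y ∷_) (dropLast-∷ʳ (z ∷ ρ) x)

  lastLetter-∷ʳ : ∀ ρ x → lastLetter (ρ ++ [ x ]) ≡ x
  lastLetter-∷ʳ [] x = refl
  lastLetter-∷ʳ (y ∷ []) x = refl
  lastLetter-∷ʳ (y ∷ z ∷ ρ) x = lastLetter-∷ʳ (z ∷ ρ) x

  lastIs-∷ʳ : ∀ ρ x j → lastIs j (ρ ++ [ x ]) ≡ (x ≡ᵇ j)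
  lastIs-∷ʳ ρ x j = lastIs-just (ρ ++ [ x ]) (last-∷ʳ ρ)
    where
    last-∷ʳ : ∀ ρ → last (ρ ++ [ x ]) ≡ just x
    last-∷ʳ [] = refl
    last-∷ʳ (y ∷ []) = refl
    last-∷ʳ (y ∷ z ∷ ρ) = last-∷ʳ (z ∷ ρ)
    lastIs-just : ∀ w → last w ≡ just x → lastIs j w ≡ (x ≡ᵇ j)
    lastIs-just w lastw with last w | lastw
    ... | just .x | refl = refl

  lastIs⇒∈ : ∀ w v → T (lastIs v w) → v ∈ w
  lastIs⇒∈ (x ∷ []) v t rewrite ≡ᵇ⇒≡ x v t = here refl
  lastIs⇒∈ (x ∷ y ∷ w) v t = there (lastIs⇒∈ (y ∷ w) v t)

  lastIs-unique : ∀ w {u v} → T (lastIs u w) → T (lastIs v w) → u ≡ v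
  lastIs-unique w {u} {v} tu tv with last w
  ... | just x = trans (sym (≡ᵇ⇒≡ x u tu)) (≡ᵇ⇒≡ x v tv)

  lastIs⇒at : ∀ {v L} w → T (lastIs v w) → length w ≡ suc L → at w L ≡ v
  lastIs⇒at {v} {L} w t len with ∷ʳ-view L w len
  ... | ρ , x , refl , refl = trans (at-∷ʳ-last ρ x) (≡ᵇ⇒≡ x v (subst T (lastIs-∷ʳ ρ x v) t))

  at⇒lastIs : ∀ {v L} w → length w ≡ suc L → at w L ≡ v → T (lastIs v w)
  at⇒lastIs {v} {L} w len wL≡v with ∷ʳ-view L w len
  ... | ρ , x , refl , refl =
    subst T (sym (lastIs-∷ʳ ρ x v)) (≡⇒≡ᵇ x v (trans (sym (at-∷ʳ-last ρ x)) wL≡v))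

  bump : ℕ → ℕ → ℕ
  bump j y = if y <ᵇ j then y else suc y

  unbump : ℕ → ℕ → ℕ
  unbump j y = if y <ᵇ j then y else pred y

  <ᵇ-true : ∀ {y j} → y < j → (y <ᵇ j) ≡ true
  <ᵇ-true {y} {j} y<j with y <ᵇ j | <⇒<ᵇ y<j
  ... | true | _ = refl

  <ᵇ-false : ∀ {y j} → j ≤ y → (y <ᵇ j) ≡ false
  <ᵇ-false {y} {j} j≤y with y <ᵇ j in y<ᵇj
  ... | false = refl
  ... | true = ⊥-elim (<⇒≱ (<ᵇ⇒< y j (subst T (sym y<ᵇj) _)) j≤y)

  bump-< : ∀ {j y} → y < j → bump j y ≡ y
  bump-< y<j rewrite <ᵇ-true y<j = refl

  bump-≥ : ∀ {j y} → j ≤ y → bump j y ≡ suc y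
  bump-≥ {j} {y} j≤y rewrite <ᵇ-false {y} {j} j≤y = refl

  unbump-< : ∀ {j y} → y < j → unbump j y ≡ y
  unbump-< y<j rewrite <ᵇ-true y<j = refl

  unbump-≥ : ∀ {j y} → j ≤ y → unbump j y ≡ pred y
  unbump-≥ {j} {y} j≤y rewrite <ᵇ-false {y} {j} j≤y = refl

  y≤bump : ∀ j y → y ≤ bump j y
  y≤bump j y with <-cmp y j
  ... | tri< y<j _ _ rewrite bump-< y<j = ≤-refl
  ... | tri≈ _ refl _ rewrite bump-≥ (≤-refl {y}) = n≤1+n y
  ... | tri> _ _ j<y rewrite bump-≥ (<⇒≤ j<y) = n≤1+n y

  bump-mono : ∀ j {a b} → a < b → bump j a < bump j b
  bump-mono j {a} {b} a<b with <-cmp a j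
  ... | tri< a<j _ _ rewrite bump-< a<j = <-≤-trans a<b (y≤bump j b)
  ... | tri≈ _ refl _ rewrite bump-≥ (≤-refl {a}) | bump-≥ (<⇒≤ a<b) = s<s a<b
  ... | tri> _ _ j<a rewrite bump-≥ (<⇒≤ j<a) | bump-≥ (<⇒≤ (<-trans j<a a<b)) = s<s a<b

  bump≢ : ∀ j y → ¬ bump j y ≡ j
  bump≢ j y with <-cmp y j
  ... | tri< y<j _ _ rewrite bump-< y<j = λ y≡j → <-irrefl y≡j y<j
  ... | tri≈ _ refl _ rewrite bump-≥ (≤-refl {y}) = λ y+1≡y → <-irrefl (sym y+1≡y) (n<1+n y)
  ... | tri> _ _ j<y rewrite bump-≥ (<⇒≤ j<y) = λ y+1≡j → <-asym j<y (subst (y <_) y+1≡j (n<1+n y))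

  unbump-mono : ∀ j {a b} → ¬ a ≡ j → ¬ b ≡ j → a < b → unbump j a < unbump j b
  unbump-mono j {a} {b} a≢j b≢j a<b with <-cmp a j | <-cmp b j
  ... | tri≈ _ a≡j _ | _ = ⊥-elim (a≢j a≡j)
  ... | _ | tri≈ _ b≡j _ = ⊥-elim (b≢j b≡j)
  ... | tri< a<j _ _ | tri< b<j _ _ rewrite unbump-< a<j | unbump-< b<j = a<b
  ... | tri< a<j _ _ | tri> _ _ j<b rewrite unbump-< a<j | unbump-≥ (<⇒≤ j<b) =
    <-≤-trans a<j (pred-mono-≤ j<b)
  ... | tri> _ _ j<a | tri< b<j _ _ = ⊥-elim (<-asym a<b (<-trans b<j j<a))
  ... | tri> _ _ j<a@(s≤s _) | tri> _ _ j<b rewrite unbump-≥ (<⇒≤ j<a) | unbump-≥ (<⇒≤ j<b) =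
    pred-mono-< a<b

  unbump-bump : ∀ j y → unbump j (bump j y) ≡ y
  unbump-bump j y with <-cmp y j
  ... | tri< y<j _ _ rewrite bump-< y<j | unbump-< y<j = refl
  ... | tri≈ _ refl _ rewrite bump-≥ (≤-refl {y}) | unbump-≥ (n≤1+n y) = refl
  ... | tri> _ _ j<y rewrite bump-≥ (<⇒≤ j<y) | unbump-≥ (≤-trans (<⇒≤ j<y) (n≤1+n y)) = refl

  bump-unbump : ∀ j y → ¬ y ≡ j → bump j (unbump j y) ≡ y
  bump-unbump j y y≢j with <-cmp y j
  ... | tri< y<j _ _ rewrite unbump-< y<j | bump-< y<j = refl
  ... | tri≈ _ y≡j _ = ⊥-elim (y≢j y≡j)
  ... | tri> _ _ (s≤s j≤y-1) rewrite unbump-≥ (<⇒≤ (s≤s j≤y-1)) | bump-≥ j≤y-1 = refl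

module Transport where

  open import Data.Nat using (ℕ; suc; s≤s⁻¹; _≤_; _<_; z<s; s<s)
  open import Data.Nat.Properties
  open import Data.Empty using (⊥-elim)
  open import Data.Product using (Σ; _×_; _,_)
  open import Data.Sum using (_⊎_; inj₁; inj₂)
  open import Data.List using (List; []; _∷_; _++_; map; length; [_])
  open import Data.List.Membership.Propositional using (_∈_)
  open import Data.List.Membership.DecPropositional _≟_ using (_∈?_)
  open import Data.List.Relation.Unary.Any using (here; there)
  open import Data.List.Relation.Unary.All as All using (All)
  open import Data.List.Relation.Unary.AllPairs using ([]; _∷_)
  open import Data.List.Relation.Unary.Unique.Propositional using (Unique)
  open import Relation.Binary.PropositionalEquality using (_≡_; refl; sym; trans; cong; subst; subst₂)
  open import Relation.Binary.Definitions using (tri<; tri≈; tri>)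
  open import Relation.Nullary using (¬_; yes; no)
  open import Function using (_∘_)
  open import Defs using (at; oneTo)
  open Counting using (unique-⊆⇒length≤)
  open Words using (length-oneTo)
  open Patterns
  open WordOps

  -- On the first n positions, every inequality between letters of u also holds in v.
  -- (A record rather than a function type, so that u and v can be inferred.)
  record OrderPreserving (n : ℕ) (u v : List ℕ) : Set where
    constructor orderPreserving
    field preserves : ∀ {i j} → i < n → j < n → at u i < at u j → at v i < at v j

  transport213 : ∀ {n u v} → OrderPreserving n u v → Has213 n u → Has213 n v
  transport213 (orderPreserving u⇒v) (has213 i<j j<k k<n a b) =
    let (i<n , j<n) = bounds i<j j<k k<n in has213 i<j j<k k<n (u⇒v j<n i<n a) (u⇒v i<n k<n b)

  transport2341 : ∀ {n u v} → OrderPreserving n u v → Has2341 n u → Has2341 n v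
  transport2341 (orderPreserving u⇒v) (has2341 i<j j<k k+1<n a b c) =
    let (i<n , j<n , k<n) = bounds⁴¹ i<j j<k k+1<n in
    has2341 i<j j<k k+1<n (u⇒v k+1<n i<n a) (u⇒v i<n j<n b) (u⇒v j<n k<n c)

  transport3241 : ∀ {n u v} → OrderPreserving n u v → Has3241 n u → Has3241 n v
  transport3241 (orderPreserving u⇒v) (has3241 i<j j<k k+1<n a b c) =
    let (i<n , j<n , k<n) = bounds⁴¹ i<j j<k k+1<n in
    has3241 i<j j<k k+1<n (u⇒v k+1<n j<n a) (u⇒v j<n i<n b) (u⇒v i<n k<n c)

  transportDistinct : ∀ {n u v} → OrderPreserving n u v → Distinct n u → Distinct n v
  transportDistinct {u = u} (orderPreserving u⇒v) u-distinct {i} {j} i<j j<n vi≡vj with <-cmp (at u i) (at u j)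
  ... | tri< ui<uj _ _ = <-irrefl vi≡vj (u⇒v (<-trans i<j j<n) j<n ui<uj)
  ... | tri≈ _ ui≡uj _ = u-distinct i<j j<n ui≡uj
  ... | tri> _ _ uj<ui = <-irrefl (sym vi≡vj) (u⇒v j<n (<-trans i<j j<n) uj<ui)

  transport𝒞 : ∀ {n u v} → OrderPreserving n u v → OrderPreserving n v u → In𝒞 n u → In𝒞 n v
  transport𝒞 u⇒v v⇒u (mkIn𝒞 d a b c) =
    mkIn𝒞 (transportDistinct u⇒v d) (a ∘ transport213 v⇒u) (b ∘ transport2341 v⇒u) (c ∘ transport3241 v⇒u)

  relabel-iso : ∀ (g : ℕ → ℕ) w n → n ≤ length w →
    (∀ {i j} → i < n → j < n → at w i < at w j → g (at w i) < g (at w j)) →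
    OrderPreserving n w (map g w) × OrderPreserving n (map g w) w
  relabel-iso g w n n≤ g-mono = forth , back
    where
    gw≡ : ∀ {i} → i < n → at (map g w) i ≡ g (at w i)
    gw≡ i<n = at-map g w (<-≤-trans i<n n≤)
    forth : OrderPreserving n w (map g w)
    forth = orderPreserving λ i<n j<n wi<wj → subst₂ _<_ (sym (gw≡ i<n)) (sym (gw≡ j<n)) (g-mono i<n j<n wi<wj)
    back : OrderPreserving n (map g w) w
    back = orderPreserving backwards
      where
      backwards : ∀ {i j} → i < n → j < n → at (map g w) i < at (map g w) j → at w i < at w j
      backwards {i} {j} i<n j<n gwi<gwj with <-cmp (at w i) (at w j)
      ... | tri< wi<wj _ _ = wi<wj
      ... | tri≈ _ wi≡wj _ = ⊥-elim (<-irrefl (trans (gw≡ i<n) (trans (cong g wi≡wj) (sym (gw≡ j<n)))) gwi<gwj)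
      ... | tri> _ _ wj<wi = ⊥-elim (<-asym gwi<gwj (subst₂ _<_ (sym (gw≡ j<n)) (sym (gw≡ i<n)) (g-mono j<n i<n wj<wi)))

  agree⇒orderPreserving : ∀ {n} u v → (∀ {i} → i < n → at u i ≡ at v i) → OrderPreserving n u v
  agree⇒orderPreserving u v agree = orderPreserving λ i<n j<n → subst₂ _<_ (agree i<n) (agree j<n)

  widen213 : ∀ {n m w} → n ≤ m → Has213 n w → Has213 m w
  widen213 n≤m (has213 a b k<n d e) = has213 a b (<-≤-trans k<n n≤m) d e

  widen2341 : ∀ {n m w} → n ≤ m → Has2341 n w → Has2341 m w
  widen2341 n≤m (has2341 a b k+1<n d e f) = has2341 a b (<-≤-trans k+1<n n≤m) d e f

  widen3241 : ∀ {n m w} → n ≤ m → Has3241 n w → Has3241 m w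
  widen3241 n≤m (has3241 a b k+1<n d e f) = has3241 a b (<-≤-trans k+1<n n≤m) d e f

  module Append (ρ : List ℕ) (x : ℕ) where
    π : List ℕ
    π = ρ ++ [ x ]

    n : ℕ
    n = length ρ

    π≡ρ : ∀ {i} → i < n → at π i ≡ at ρ i
    π≡ρ = at-∷ʳ-init ρ x

    π⇒ρ : OrderPreserving n π ρ
    π⇒ρ = agree⇒orderPreserving π ρ π≡ρ

    ρ⇒π : OrderPreserving n ρ π
    ρ⇒π = agree⇒orderPreserving ρ π (λ i<n → sym (π≡ρ i<n))

    in𝒞-init : In𝒞 (suc n) π → In𝒞 n ρ
    in𝒞-init (mkIn𝒞 d a b c) = mkIn𝒞
      (transportDistinct π⇒ρ (λ i<j j<n → d i<j (<-trans j<n (n<1+n n))))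
      (λ h → a (widen213 (n≤1+n n) (transport213 ρ⇒π h)))
      (λ h → b (widen2341 (n≤1+n n) (transport2341 ρ⇒π h)))
      (λ h → c (widen3241 (n≤1+n n) (transport3241 ρ⇒π h)))

    distinct-last : Distinct (suc n) π → ∀ {i} → i < n → ¬ at ρ i ≡ x
    distinct-last d {i} i<n ρi≡x = d i<n (n<1+n n) (trans (π≡ρ i<n) (trans ρi≡x (sym (at-∷ʳ-last ρ x))))

    distinct-append : Distinct n ρ → (∀ {i} → i < n → ¬ at ρ i ≡ x) → Distinct (suc n) π
    distinct-append d x-new {i} {j} i<j j<n+1 πi≡πj with m≤n⇒m<n∨m≡n (s≤s⁻¹ j<n+1)
    ... | inj₁ j<n = d i<j j<n (trans (sym (π≡ρ (<-trans i<j j<n))) (trans πi≡πj (π≡ρ j<n)))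
    ... | inj₂ refl = x-new i<j (trans (sym (π≡ρ i<j)) (trans πi≡πj (at-∷ʳ-last ρ x)))

    split213 : Has213 (suc n) π → Has213 n ρ ⊎
      (Σ ℕ λ i → Σ ℕ λ j → i < j × j < n × at ρ j < at ρ i × at ρ i < x)
    split213 (has213 {i} {j} i<j j<k k<n+1 πj<πi πi<πk) with m≤n⇒m<n∨m≡n (s≤s⁻¹ k<n+1)
    ... | inj₁ k<n = inj₁ (transport213 π⇒ρ (has213 i<j j<k k<n πj<πi πi<πk))
    ... | inj₂ refl = inj₂ (i , j , i<j , j<k ,
      subst₂ _<_ (π≡ρ j<k) (π≡ρ (<-trans i<j j<k)) πj<πi ,
      subst₂ _<_ (π≡ρ (<-trans i<j j<k)) (at-∷ʳ-last ρ x) πi<πk)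

  module AppendAfter (ρ : List ℕ) (x L : ℕ) (lenρ : length ρ ≡ suc L) where
    open Append ρ x

    π≡ρ' : ∀ {i} → i < suc L → at π i ≡ at ρ i
    π≡ρ' i<L+1 = π≡ρ (subst (_ <_) (sym lenρ) i<L+1)

    πlast : at π (suc L) ≡ x
    πlast = subst (λ m → at π m ≡ x) lenρ (at-∷ʳ-last ρ x)

    split2341 : Has2341 (suc (suc L)) π → Has2341 (suc L) ρ ⊎
      (Σ ℕ λ i → Σ ℕ λ j → i < j × j < L × x < at ρ i × at ρ i < at ρ j × at ρ j < at ρ L)
    split2341 (has2341 {i} {j} i<j j<k k+1<n a b c) with m≤n⇒m<n∨m≡n (s≤s⁻¹ k+1<n)
    ... | inj₁ k+1<L+1 = inj₁ (transport2341 (agree⇒orderPreserving π ρ π≡ρ') (has2341 i<j j<k k+1<L+1 a b c))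
    ... | inj₂ refl = let (i<L+1 , j<L+1) = bounds i<j j<k (n<1+n L) in inj₂ (i , j , i<j , j<k ,
      subst₂ _<_ πlast (π≡ρ' i<L+1) a , subst₂ _<_ (π≡ρ' i<L+1) (π≡ρ' j<L+1) b ,
      subst₂ _<_ (π≡ρ' j<L+1) (π≡ρ' (n<1+n L)) c)

    split3241 : Has3241 (suc (suc L)) π → Has3241 (suc L) ρ ⊎
      (Σ ℕ λ i → Σ ℕ λ j → i < j × j < L × x < at ρ j × at ρ j < at ρ i × at ρ i < at ρ L)
    split3241 (has3241 {i} {j} i<j j<k k+1<n a b c) with m≤n⇒m<n∨m≡n (s≤s⁻¹ k+1<n)
    ... | inj₁ k+1<L+1 = inj₁ (transport3241 (agree⇒orderPreserving π ρ π≡ρ') (has3241 i<j j<k k+1<L+1 a b c))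
    ... | inj₂ refl = let (i<L+1 , j<L+1) = bounds i<j j<k (n<1+n L) in inj₂ (i , j , i<j , j<k ,
      subst₂ _<_ πlast (π≡ρ' j<L+1) a , subst₂ _<_ (π≡ρ' j<L+1) (π≡ρ' i<L+1) b ,
      subst₂ _<_ (π≡ρ' i<L+1) (π≡ρ' (n<1+n L)) c)

  distinct⇒unique : ∀ w → Distinct (length w) w → Unique w
  distinct⇒unique [] _ = []
  distinct⇒unique (x ∷ w) d =
    All.tabulate (λ y∈w x≡y → let (i , i< , wi≡y) = ∈⇒at y∈w in
      d {0} {suc i} z<s (s<s i<) (trans x≡y (sym wi≡y)))
    ∷ distinct⇒unique w (λ i<j j<n → d (s<s i<j) (s<s j<n))

  pigeonhole : ∀ m w → length w ≡ m → Distinct m w → All (_∈ oneTo m) w →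
    ∀ y → y ∈ oneTo m → Σ ℕ λ p → p < m × at w p ≡ y
  pigeonhole m w refl d letters y y∈ with y ∈? w
  ... | yes y∈w = let (p , p< , wp≡y) = ∈⇒at y∈w in p , p< , wp≡y
  ... | no y∉w = ⊥-elim (<-irrefl refl (subst (suc (length w) ≤_) (length-oneTo (length w))
         (unique-⊆⇒length≤ (y ∷ w) (oneTo (length w)) (y∉ ∷ distinct⇒unique w d) y∷w⊆)))
    where
    y∉ : All (λ z → ¬ y ≡ z) w
    y∉ = All.tabulate (λ z∈w y≡z → y∉w (subst (_∈ w) (sym y≡z) z∈w))
    y∷w⊆ : ∀ {z} → z ∈ y ∷ w → z ∈ oneTo (length w)
    y∷w⊆ (here refl) = y∈
    y∷w⊆ (there z∈w) = All.lookup letters z∈w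

-- Let π ∈ 𝒞_{L+2} end with j = j₀ + 1 and let a be its penultimate letter.  Then a
-- is neither below j₀ (else j₀, a, j would form a 2-1-3) nor above j + 2 (else j+1,
-- j+2, a, j would form a 2-3-41 or a 3-2-41).  Hence deleting j and closing the gap
-- yields σ ∈ 𝒞_{L+1} ending in j₀, j₀ + 1 or j₀ + 2.  Conversely, making room for j in
-- such a σ and appending j creates none of the three patterns.
module LastLetter where

  open import Data.Nat using (ℕ; suc; pred; s≤s⁻¹; _≤_; _<_; z≤n; s≤s; z<s)
  open import Data.Nat.Properties
  open import Data.Empty using (⊥; ⊥-elim)
  open import Data.Product using (Σ; _×_; _,_; proj₁; proj₂)
  open import Data.Sum using (_⊎_; inj₁; inj₂)
  open import Data.List using (List; _++_; map; length; [_])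
  open import Data.List.Properties using (length-map; map-∘; map-id-local)
  open import Data.List.Membership.Propositional using (_∈_)
  open import Data.List.Membership.Propositional.Properties using (∈-++⁺ʳ)
  open import Data.List.Relation.Unary.Any using (here)
  open import Data.List.Relation.Unary.All as All using (All; []; _∷_)
  import Data.List.Relation.Unary.All.Properties as All
  open import Data.Bool using (T)
  open import Relation.Binary.PropositionalEquality using (_≡_; refl; sym; trans; cong; subst; subst₂)
  open import Relation.Binary.Definitions using (tri<; tri≈; tri>)
  open import Relation.Nullary using (¬_)
  open import Defs using (at; oneTo; lastIs; words)
  open Words
  open Patterns
  open WordOps
  open Transport

  insertLast : ℕ → List ℕ → List ℕ
  insertLast j σ = map (bump j) σ ++ [ j ]

  removeLast : List ℕ → List ℕ
  removeLast π = map (unbump (lastLetter π)) (dropLast π)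

  removeLast-∷ʳ : ∀ ρ x → removeLast (ρ ++ [ x ]) ≡ map (unbump x) ρ
  removeLast-∷ʳ ρ x rewrite lastLetter-∷ʳ ρ x | dropLast-∷ʳ ρ x = refl

  NearLetter : ℕ → ℕ → Set
  NearLetter j₀ v = v ≡ j₀ ⊎ v ≡ suc j₀ ⊎ v ≡ suc (suc j₀)

  near-bump≤ : ∀ j₀ v → NearLetter j₀ v → bump (suc j₀) v ≤ suc (suc (suc j₀))
  near-bump≤ j₀ _ (inj₁ refl) rewrite bump-< (n<1+n j₀) = m≤n+m j₀ 3
  near-bump≤ j₀ _ (inj₂ (inj₁ refl)) rewrite bump-≥ (≤-refl {suc j₀}) = n≤1+n (suc (suc j₀))
  near-bump≤ j₀ _ (inj₂ (inj₂ refl)) rewrite bump-≥ (n≤1+n (suc j₀)) = ≤-refl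

  near-below : ∀ j₀ v y → NearLetter j₀ v → ¬ y ≡ bump (suc j₀) v → y < suc j₀ → y < bump (suc j₀) v
  near-below j₀ _ y (inj₁ refl) y≢ y<j rewrite bump-< (n<1+n j₀) with m≤n⇒m<n∨m≡n (s≤s⁻¹ y<j)
  ... | inj₁ y<j₀ = y<j₀
  ... | inj₂ y≡j₀ = ⊥-elim (y≢ y≡j₀)
  near-below j₀ _ y (inj₂ (inj₁ refl)) _ y<j rewrite bump-≥ (≤-refl {suc j₀}) = m<n⇒m<1+n y<j
  near-below j₀ _ y (inj₂ (inj₂ refl)) _ y<j rewrite bump-≥ (n≤1+n (suc j₀)) =
    m<n⇒m<1+n (m<n⇒m<1+n y<j)

  near-gap : ∀ j₀ v y → NearLetter j₀ v → bump (suc j₀) v < y → y < suc j₀ → ⊥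
  near-gap j₀ _ y (inj₁ refl) b<y y<j rewrite bump-< (n<1+n j₀) = <-irrefl refl (<-≤-trans b<y (s≤s⁻¹ y<j))
  near-gap j₀ _ y (inj₂ (inj₁ refl)) b<y y<j rewrite bump-≥ (≤-refl {suc j₀}) =
    <-asym y<j (<-trans (n<1+n (suc j₀)) b<y)
  near-gap j₀ _ y (inj₂ (inj₂ refl)) b<y y<j rewrite bump-≥ (n≤1+n (suc j₀)) =
    <-asym y<j (<-trans (m<n+m (suc j₀) {2} z<s) b<y)

  -- A near letter v has j ≤ v + 1, so j stays within the alphabet when v does.
  near-≥ : ∀ j₀ v → NearLetter j₀ v → suc j₀ ≤ suc v
  near-≥ j₀ _ (inj₁ refl) = ≤-refl
  near-≥ j₀ _ (inj₂ (inj₁ refl)) = n≤1+n (suc j₀)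
  near-≥ j₀ _ (inj₂ (inj₂ refl)) = m≤n+m (suc j₀) 2

  no-room : ∀ {j b c d} → j < b → b < c → c < d → d ≤ suc (suc j) → ⊥
  no-room j<b b<c c<d d≤ = 1+n≰n (≤-trans (≤-trans (s≤s (≤-trans (s≤s j<b) b<c)) c<d) d≤)

  module Removal (ρ : List ℕ) (L j₀ : ℕ) (lenρ : length ρ ≡ suc L)
    (letters : All (_∈ oneTo (suc (suc L))) (ρ ++ [ suc j₀ ]))
    (π∈𝒞 : In𝒞 (suc (suc L)) (ρ ++ [ suc j₀ ])) where

    j : ℕ
    j = suc j₀
    open Append ρ j
    open AppendAfter ρ j L lenρ
    open In𝒞 π∈𝒞

    L<n : L < n
    L<n = subst (L <_) (sym lenρ) (n<1+n L)

    j-new : ∀ {i} → i < n → ¬ at ρ i ≡ j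
    j-new = distinct-last (λ i<k k<n+1 → distinctLetters i<k (subst (λ m → _ < suc m) lenρ k<n+1))

    a : ℕ
    a = at ρ L

    πL≡a : at π L ≡ a
    πL≡a = π≡ρ' (n<1+n L)

    ρ-letters : All (_∈ oneTo (suc (suc L))) ρ
    ρ-letters = All.++⁻ˡ ρ letters

    a≤ : a ≤ suc (suc L)
    a≤ = proj₂ (∈-oneTo⁻ (All.lookup ρ-letters (at-∈ ρ L<n)))

    j≤ : j ≤ suc (suc L)
    j≤ = proj₂ (∈-oneTo⁻ (All.lookup letters (∈-++⁺ʳ ρ (here refl))))

    position-of : ∀ y → 0 < y → y ≤ suc (suc L) → Σ ℕ λ p → p < suc (suc L) × at π p ≡ y
    position-of y 0<y y≤ =
      pigeonhole (suc (suc L)) π (trans (length-∷ʳ ρ j) (cong suc lenρ)) distinctLetters letters y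
        (∈-oneTo⁺ 0<y y≤)

    earlier : ∀ {p y} → p < suc (suc L) → at π p ≡ y → ¬ y ≡ a → ¬ y ≡ j → p < L
    earlier {p} p< πp≡y y≢a y≢j with m≤n⇒m<n∨m≡n (s≤s⁻¹ p<)
    ... | inj₂ refl = ⊥-elim (y≢j (trans (sym πp≡y) πlast))
    ... | inj₁ p<L+1 with m≤n⇒m<n∨m≡n (s≤s⁻¹ p<L+1)
    ...   | inj₁ p<L = p<L
    ...   | inj₂ refl = ⊥-elim (y≢a (trans (sym πp≡y) πL≡a))

    -- if a < j₀, then j₀ occurs earlier and j₀, a, j form a 2-1-3
    a≮j₀ : ¬ a < j₀
    a≮j₀ a<j₀ with position-of j₀ (≤-<-trans z≤n a<j₀) (≤-trans (n≤1+n j₀) j≤)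
    ... | p , p< , πp≡j₀ = avoids213 (has213 (earlier p< πp≡j₀ (λ j₀≡a → <-irrefl (sym j₀≡a) a<j₀)
            (λ j₀≡j → <-irrefl j₀≡j (n<1+n j₀))) (n<1+n L) (n<1+n (suc L))
            (subst₂ _<_ (sym πL≡a) (sym πp≡j₀) a<j₀) (subst₂ _<_ (sym πp≡j₀) (sym πlast) (n<1+n j₀)))

    no-two-between : ∀ {p q} → p < L → q < L →
      at π (suc L) < at π p → at π p < at π q → at π q < at π L → ⊥
    no-two-between {p} {q} p<L q<L j<πp πp<πq πq<a with <-cmp p q
    ... | tri< p<q _ _ = avoids2341 (has2341 p<q q<L (n<1+n (suc L)) j<πp πp<πq πq<a)
    ... | tri≈ _ refl _ = <-irrefl refl πp<πq
    ... | tri> _ _ q<p = avoids3241 (has3241 q<p p<L (n<1+n (suc L)) j<πp πp<πq πq<a)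

    -- if a > j + 2, then j + 1 and j + 2 occur earlier, between j and a
    a≯j+2 : ¬ suc (suc j) < a
    a≯j+2 j+2<a with position-of (suc j) z<s (≤-trans (<⇒≤ (<-trans (n<1+n (suc j)) j+2<a)) a≤)
                   | position-of (suc (suc j)) z<s (≤-trans (<⇒≤ j+2<a) a≤)
    ... | p , p< , πp≡j+1 | q , q< , πq≡j+2 = no-two-between p<L q<L
      (subst₂ _<_ (sym πlast) (sym πp≡j+1) (n<1+n j))
      (subst₂ _<_ (sym πp≡j+1) (sym πq≡j+2) (n<1+n (suc j)))
      (subst₂ _<_ (sym πq≡j+2) (sym πL≡a) j+2<a)
      where
      j+1<a : suc j < a
      j+1<a = <-trans (n<1+n (suc j)) j+2<a
      p<L : p < L
      p<L = earlier p< πp≡j+1 (λ j+1≡a → <-irrefl j+1≡a j+1<a) (λ j+1≡j → <-irrefl (sym j+1≡j) (n<1+n j))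
      q<L : q < L
      q<L = earlier q< πq≡j+2 (λ j+2≡a → <-irrefl j+2≡a j+2<a)
              (λ j+2≡j → <-irrefl (sym j+2≡j) (<-trans (n<1+n j) (n<1+n (suc j))))

    a-near : NearLetter j₀ (unbump j a)
    a-near with <-cmp a j
    ... | tri≈ _ a≡j _ = ⊥-elim (j-new L<n a≡j)
    ... | tri< a<j _ _ with m≤n⇒m<n∨m≡n (s≤s⁻¹ a<j)
    ...   | inj₁ a<j₀ = ⊥-elim (a≮j₀ a<j₀)
    ...   | inj₂ a≡j₀ = inj₁ (trans (unbump-< a<j) a≡j₀)
    a-near | tri> _ _ j<a with m≤n⇒m<n∨m≡n j<a
    ...   | inj₂ j+1≡a = inj₂ (inj₁ (trans (unbump-≥ (<⇒≤ j<a)) (cong pred (sym j+1≡a))))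
    ...   | inj₁ j+1<a with m≤n⇒m<n∨m≡n j+1<a
    ...     | inj₂ j+2≡a = inj₂ (inj₂ (trans (unbump-≥ (<⇒≤ j<a)) (cong pred (sym j+2≡a))))
    ...     | inj₁ j+2<a = ⊥-elim (a≯j+2 j+2<a)

    σ : List ℕ
    σ = map (unbump j) ρ

    σ-length : length σ ≡ suc L
    σ-length = trans (length-map (unbump j) ρ) lenρ

    σ∈words : σ ∈ words (suc L) (suc L)
    σ∈words = subst (λ m → σ ∈ words m (suc L)) σ-length (words-complete σ σ-letters)
      where
      unbump-letter : ∀ {y} → y ∈ oneTo (suc (suc L)) → ¬ y ≡ j → unbump j y ∈ oneTo (suc L)
      unbump-letter {y} y∈ y≢j with ∈-oneTo⁻ y∈ | <-cmp y j
      ... | _ | tri≈ _ y≡j _ = ⊥-elim (y≢j y≡j)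
      ... | 0<y , _ | tri< y<j _ _ rewrite unbump-< y<j = ∈-oneTo⁺ 0<y (s≤s⁻¹ (≤-trans y<j j≤))
      ... | _ , y≤ | tri> _ _ j<y@(s≤s j≤y-1) rewrite unbump-≥ (<⇒≤ j<y) =
            ∈-oneTo⁺ (≤-trans (s≤s z≤n) j≤y-1) (pred-mono-≤ y≤)
      σ-letters : All (_∈ oneTo (suc L)) σ
      σ-letters = All.map⁺ (All.tabulate λ y∈ρ →
        let (i , i< , ρi≡y) = ∈⇒at y∈ρ in
        unbump-letter (All.lookup ρ-letters y∈ρ) (λ y≡j → j-new i< (trans ρi≡y y≡j)))

    σ∈𝒞 : In𝒞 (suc L) σ
    σ∈𝒞 = subst (λ m → In𝒞 m σ) lenρ (transport𝒞 (proj₁ isos) (proj₂ isos) (in𝒞-init π∈𝒞'))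
      where
      π∈𝒞' : In𝒞 (suc n) π
      π∈𝒞' = subst (λ m → In𝒞 (suc m) π) (sym lenρ) π∈𝒞
      isos : OrderPreserving n ρ σ × OrderPreserving n σ ρ
      isos = relabel-iso (unbump j) ρ n ≤-refl (λ i< k< → unbump-mono j (j-new i<) (j-new k<))

    σ-ends : T (lastIs (unbump j a) σ)
    σ-ends = at⇒lastIs σ σ-length (at-map (unbump j) ρ L<n)

    insert-σ : insertLast j σ ≡ π
    insert-σ = cong (_++ [ j ]) (trans (sym (map-∘ ρ)) (map-id-local (All.tabulate λ y∈ρ →
      let (i , i< , ρi≡y) = ∈⇒at y∈ρ in bump-unbump j _ (λ y≡j → j-new i< (trans ρi≡y y≡j)))))

  module Insertion (σ : List ℕ) (L j₀ v : ℕ) (lenσ : length σ ≡ suc L)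
    (letters : All (_∈ oneTo (suc L)) σ) (σ∈𝒞 : In𝒞 (suc L) σ)
    (σ-ends : T (lastIs v σ)) (near : NearLetter j₀ v) where

    j : ℕ
    j = suc j₀
    ρ : List ℕ
    ρ = map (bump j) σ

    ρ-length : length ρ ≡ suc L
    ρ-length = trans (length-map (bump j) σ) lenσ

    open Append ρ j
    open AppendAfter ρ j L ρ-length

    ρL≡b : at ρ L ≡ bump j v
    ρL≡b = trans (at-map (bump j) σ (subst (L <_) (sym lenσ) (n<1+n L))) (cong (bump j) (lastIs⇒at σ σ-ends lenσ))

    ρ∈𝒞 : In𝒞 (suc L) ρ
    ρ∈𝒞 = transport𝒞 (proj₁ isos) (proj₂ isos) σ∈𝒞
      where
      isos : OrderPreserving (suc L) σ ρ × OrderPreserving (suc L) ρ σ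
      isos = relabel-iso (bump j) σ (suc L) (≤-reflexive (sym lenσ)) (λ _ _ → bump-mono j)

    open In𝒞 ρ∈𝒞

    ρ∈𝒞' : In𝒞 n ρ
    ρ∈𝒞' = subst (λ m → In𝒞 m ρ) (sym ρ-length) ρ∈𝒞

    -- a 2-1-3 ending with j would need an earlier letter below j and above ρ_L, or
    -- a letter between ρ_L and j
    π-avoids213 : ¬ Has213 (suc n) π
    π-avoids213 h with split213 h
    ... | inj₁ h' = In𝒞.avoids213 ρ∈𝒞' h'
    ... | inj₂ (i , k , i<k , k<n , ρk<ρi , ρi<j) with m≤n⇒m<n∨m≡n (s≤s⁻¹ (subst (k <_) ρ-length k<n))
    ...   | inj₁ k<L = avoids213 (has213 i<k k<L (n<1+n L) ρk<ρi
              (subst (at ρ i <_) (sym ρL≡b) (near-below j₀ v (at ρ i) near ρi≢b ρi<j)))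
      where
      ρi≢b : ¬ at ρ i ≡ bump j v
      ρi≢b ρi≡b = distinctLetters (<-trans i<k k<L) (n<1+n L) (trans ρi≡b (sym ρL≡b))
    ...   | inj₂ refl = near-gap j₀ v (at ρ i) near (subst (_< at ρ i) ρL≡b ρk<ρi) ρi<j

    -- a 2-3-41 or 3-2-41 ending with j would need three letters between j and ρ_L ≤ j + 2
    π-avoids2341 : ¬ Has2341 (suc (suc L)) π
    π-avoids2341 h with split2341 h
    ... | inj₁ h' = avoids2341 h'
    ... | inj₂ (_ , _ , _ , _ , a , b , c) = no-room a b c (subst (_≤ suc (suc j)) (sym ρL≡b) (near-bump≤ j₀ v near))

    π-avoids3241 : ¬ Has3241 (suc (suc L)) π
    π-avoids3241 h with split3241 h
    ... | inj₁ h' = avoids3241 h'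
    ... | inj₂ (_ , _ , _ , _ , a , b , c) = no-room a b c (subst (_≤ suc (suc j)) (sym ρL≡b) (near-bump≤ j₀ v near))

    π∈𝒞 : In𝒞 (suc (suc L)) π
    π∈𝒞 = mkIn𝒞 (subst (λ m → Distinct (suc m) π) ρ-length π-distinct)
      (λ h → π-avoids213 (subst (λ m → Has213 (suc m) π) (sym ρ-length) h)) π-avoids2341 π-avoids3241
      where
      π-distinct : Distinct (suc n) π
      π-distinct = distinct-append (In𝒞.distinctLetters ρ∈𝒞') (λ {i} i<n ρi≡j →
        bump≢ j (at σ i) (trans (sym (at-map (bump j) σ (subst (i <_) (length-map (bump j) σ) i<n))) ρi≡j))

    π∈words : π ∈ words (suc (suc L)) (suc (suc L))
    π∈words = subst (λ m → π ∈ words m (suc (suc L))) (trans (length-∷ʳ ρ j) (cong suc ρ-length))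
      (words-complete π (All.++⁺ (All.map⁺ (All.map bump-letter letters)) (j-letter ∷ [])))
      where
      bump-letter : ∀ {y} → y ∈ oneTo (suc L) → bump j y ∈ oneTo (suc (suc L))
      bump-letter {y} y∈ with ∈-oneTo⁻ y∈ | <-cmp y j
      ... | 0<y , y≤ | tri< y<j _ _ rewrite bump-< y<j = ∈-oneTo⁺ 0<y (m≤n⇒m≤1+n y≤)
      ... | _ , y≤ | tri≈ _ refl _ rewrite bump-≥ (≤-refl {y}) = ∈-oneTo⁺ z<s (s≤s y≤)
      ... | _ , y≤ | tri> _ _ j<y rewrite bump-≥ (<⇒≤ j<y) = ∈-oneTo⁺ z<s (s≤s y≤)
      v≤ : v ≤ suc L
      v≤ = proj₂ (∈-oneTo⁻ (All.lookup letters (lastIs⇒∈ σ v σ-ends)))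
      j-letter : j ∈ oneTo (suc (suc L))
      j-letter = ∈-oneTo⁺ z<s (≤-trans (near-≥ j₀ v near) (s≤s v≤))

    π-ends : T (lastIs j π)
    π-ends = subst T (sym (lastIs-∷ʳ ρ j j)) (≡⇒≡ᵇ j j refl)

    remove-π : removeLast π ≡ σ
    remove-π = trans (removeLast-∷ʳ ρ j)
      (trans (sym (map-∘ σ)) (map-id-local (All.tabulate λ {y} _ → unbump-bump j y)))

module Recurrence where

  open import Data.Nat using (ℕ; suc; _+_)
  open import Data.Nat.Properties using (<-irrefl; n<1+n; <-trans; +-assoc; ≡ᵇ⇒≡)
  open import Data.Bool using (T; _∧_)
  open import Data.Product using (Σ; _×_; _,_; proj₁)
  open import Data.Sum using (_⊎_; inj₁; inj₂)
  open import Data.List using (List; length; filter)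
  open import Data.List.Properties using (filter-≐; filter-none)
  open import Data.List.Membership.Propositional using (_∈_)
  open import Data.List.Relation.Unary.All as All using (All)
  open import Relation.Nullary using (¬_; _⊎-dec_)
  open import Relation.Nullary.Decidable using (map′; T?)
  open import Relation.Unary using (Decidable)
  open import Relation.Binary.PropositionalEquality
  open import Defs using (countC; inC; lastIs; words)
  open Counting
  open Words
  open Patterns
  open WordOps
  open LastLetter

  Ending : ℕ → ℕ → List ℕ → Set
  Ending n j w = In𝒞 n w × T (lastIs j w)

  ending⁻ : ∀ {n j w} → T (inC n w ∧ lastIs j w) → Ending n j w
  ending⁻ {n} {j} {w} t = let (w∈𝒞 , ends) = ∧⁻ {inC n w} t in decode𝒞 n w w∈𝒞 , ends

  ending⁺ : ∀ {n j w} → Ending n j w → T (inC n w ∧ lastIs j w)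
  ending⁺ {n} {j} {w} (w∈𝒞 , ends) = ∧⁺ (encode𝒞 n w w∈𝒞) ends

  ending? : ∀ n j → Decidable (Ending n j)
  ending? n j w = map′ ending⁻ ending⁺ (T? (inC n w ∧ lastIs j w))

  countC≡ : ∀ n j → countC n j ≡ length (filter (ending? n j) (words n n))
  countC≡ n j = cong length (filter-≐ _ (ending? n j) (ending⁻ , ending⁺) (words n n))

  countC-0 : ∀ n → countC n 0 ≡ 0
  countC-0 n = trans (countC≡ n 0) (cong length (filter-none (ending? n 0) (All.tabulate no-0)))
    where
    no-0 : ∀ {w} → w ∈ words n n → ¬ Ending n 0 w
    no-0 {w} w∈ (_ , ends) = <-irrefl refl (proj₁ (∈-oneTo⁻ (All.lookup (words-letters {n} {n} w∈) (lastIs⇒∈ w 0 ends))))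

  endings-disjoint : ∀ n {u v} → ¬ u ≡ v → ∀ w → ¬ (Ending n u w × Ending n v w)
  endings-disjoint n u≢v w ((_ , ends-u) , (_ , ends-v)) = u≢v (lastIs-unique w ends-u ends-v)

  NearEnding : ℕ → ℕ → List ℕ → Set
  NearEnding n j₀ w = Ending n j₀ w ⊎ Ending n (suc j₀) w ⊎ Ending n (suc (suc j₀)) w

  nearEnding? : ∀ n j₀ → Decidable (NearEnding n j₀)
  nearEnding? n j₀ w = ending? n j₀ w ⊎-dec ending? n (suc j₀) w ⊎-dec ending? n (suc (suc j₀)) w

  nearEnding⁺ : ∀ {n j₀ v w} → In𝒞 n w → NearLetter j₀ v → T (lastIs v w) → NearEnding n j₀ w
  nearEnding⁺ w∈𝒞 (inj₁ refl) ends = inj₁ (w∈𝒞 , ends)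
  nearEnding⁺ w∈𝒞 (inj₂ (inj₁ refl)) ends = inj₂ (inj₁ (w∈𝒞 , ends))
  nearEnding⁺ w∈𝒞 (inj₂ (inj₂ refl)) ends = inj₂ (inj₂ (w∈𝒞 , ends))

  nearEnding⁻ : ∀ {n j₀ w} → NearEnding n j₀ w → Σ ℕ λ v → NearLetter j₀ v × In𝒞 n w × T (lastIs v w)
  nearEnding⁻ (inj₁ (w∈𝒞 , ends)) = _ , inj₁ refl , w∈𝒞 , ends
  nearEnding⁻ (inj₂ (inj₁ (w∈𝒞 , ends))) = _ , inj₂ (inj₁ refl) , w∈𝒞 , ends
  nearEnding⁻ (inj₂ (inj₂ (w∈𝒞 , ends))) = _ , inj₂ (inj₂ refl) , w∈𝒞 , ends

  -- Removing the last letter is a bijection from the words of 𝒞_{L+2} ending in j₀ + 1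
  -- onto the words of 𝒞_{L+1} ending near j₀ + 1, with inverse `insertLast (j₀ + 1)`.
  countC-removeLast : ∀ L j₀ →
    countC (suc (suc L)) (suc j₀) ≡ length (filter (nearEnding? (suc L) j₀) (words (suc L) (suc L)))
  countC-removeLast L j₀ = trans (countC≡ (suc (suc L)) j)
    (count-≡ (ending? (suc (suc L)) j) (nearEnding? (suc L) j₀) (words-unique (suc (suc L)) (suc (suc L))) (words-unique (suc L) (suc L))
      removeLast (insertLast j) removing inserting)
    where
    j : ℕ
    j = suc j₀
    removing : ∀ {π} → π ∈ words (suc (suc L)) (suc (suc L)) → Ending (suc (suc L)) j π →
      (removeLast π ∈ words (suc L) (suc L) × NearEnding (suc L) j₀ (removeLast π)) ×
      insertLast j (removeLast π) ≡ π
    removing {π} π∈ (π∈𝒞 , π-ends) with ∷ʳ-view (suc L) π (words-length {suc (suc L)} {suc (suc L)} π∈)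
    ... | ρ , x , refl , lenρ with ≡ᵇ⇒≡ x j (subst T (lastIs-∷ʳ ρ x j) π-ends)
    ... | refl rewrite removeLast-∷ʳ ρ j =
      (σ∈words , nearEnding⁺ σ∈𝒞 a-near σ-ends) , insert-σ
      where open Removal ρ L j₀ lenρ (words-letters {suc (suc L)} {suc (suc L)} π∈) π∈𝒞
    inserting : ∀ {σ} → σ ∈ words (suc L) (suc L) → NearEnding (suc L) j₀ σ →
      (insertLast j σ ∈ words (suc (suc L)) (suc (suc L)) × Ending (suc (suc L)) j (insertLast j σ)) ×
      removeLast (insertLast j σ) ≡ σ
    inserting {σ} σ∈ near-end with nearEnding⁻ near-end
    ... | v , near , σ∈𝒞 , σ-ends = (π∈words , π∈𝒞 , π-ends) , remove-π
      where open Insertion σ L j₀ v (words-length {suc L} {suc L} σ∈) (words-letters {suc L} {suc L} σ∈) σ∈𝒞 σ-ends near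

  count-nearEnding : ∀ n j₀ → length (filter (nearEnding? n j₀) (words n n)) ≡
    countC n j₀ + countC n (suc j₀) + countC n (suc (suc j₀))
  count-nearEnding n j₀ = begin
    length (filter (nearEnding? n j₀) (words n n))
      ≡⟨ count-⊎ (E j₀) (λ w → E j w ⊎-dec E (suc j) w) E₀∩E₁₂ (words n n) ⟩
    # j₀ + length (filter (λ w → E j w ⊎-dec E (suc j) w) (words n n))
      ≡⟨ cong (# j₀ +_) (count-⊎ (E j) (E (suc j)) E₁∩E₂ (words n n)) ⟩
    # j₀ + (# j + # (suc j))
      ≡⟨ sym (+-assoc (# j₀) _ _) ⟩
    # j₀ + # j + # (suc j)
      ≡⟨ sym (cong₂ _+_ (cong₂ _+_ (countC≡ n j₀) (countC≡ n j)) (countC≡ n (suc j))) ⟩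
    countC n j₀ + countC n j + countC n (suc j) ∎
    where
    open ≡-Reasoning
    j : ℕ
    j = suc j₀
    E : ∀ v → Decidable (Ending n v)
    E = ending? n
    # : ℕ → ℕ
    # v = length (filter (E v) (words n n))
    E₀∩E₁₂ : ∀ w → ¬ (Ending n j₀ w × (Ending n j w ⊎ Ending n (suc j) w))
    E₀∩E₁₂ w (e₀ , inj₁ e₁) = endings-disjoint n (λ j₀≡j → <-irrefl j₀≡j (n<1+n j₀)) w (e₀ , e₁)
    E₀∩E₁₂ w (e₀ , inj₂ e₂) =
      endings-disjoint n (λ j₀≡j+1 → <-irrefl j₀≡j+1 (<-trans (n<1+n j₀) (n<1+n j))) w (e₀ , e₂)
    E₁∩E₂ : ∀ w → ¬ (Ending n j w × Ending n (suc j) w)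
    E₁∩E₂ = endings-disjoint n (λ j≡j+1 → <-irrefl j≡j+1 (n<1+n j))

  recurrence : ∀ L j₀ → countC (suc (suc L)) (suc j₀) ≡
    countC (suc L) j₀ + countC (suc L) (suc j₀) + countC (suc L) (suc (suc j₀))
  recurrence L j₀ = trans (countC-removeLast L j₀) (count-nearEnding (suc L) j₀)

module Series where

  open import Data.Nat as ℕ using (zero; suc; _≤_; z≤n)
  import Data.Nat.Properties as ℕ
  open import Data.Integer using (_+_; _*_; 0ℤ)
  open import Data.Integer.Properties using (+-assoc; *-distribˡ-+)
  open import Data.Integer.Tactic.RingSolver using (solve-∀)
  open import Function using (_∘_)
  open import Relation.Binary.PropositionalEquality using (_≡_; refl; sym; trans; cong; cong₂)
  open import Defs using (Σ≤; Ser₁; _*₁_)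

  Σ≤-shift : ∀ n f → Σ≤ (suc n) f ≡ f 0 + Σ≤ n (f ∘ suc)
  Σ≤-shift zero f = refl
  Σ≤-shift (suc n) f = trans (cong (_+ f (suc (suc n))) (Σ≤-shift n f)) (+-assoc (f 0) _ _)

  Σ≤-cong : ∀ n {f g} → (∀ a → a ≤ n → f a ≡ g a) → Σ≤ n f ≡ Σ≤ n g
  Σ≤-cong zero f≡g = f≡g 0 z≤n
  Σ≤-cong (suc n) f≡g = cong₂ _+_ (Σ≤-cong n (λ a a≤n → f≡g a (ℕ.m≤n⇒m≤1+n a≤n))) (f≡g (suc n) ℕ.≤-refl)

  Σ≤-zero : ∀ n {f} → (∀ a → a ≤ n → f a ≡ 0ℤ) → Σ≤ n f ≡ 0ℤ
  Σ≤-zero zero f≡0 = f≡0 0 z≤n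
  Σ≤-zero (suc n) f≡0 = cong₂ _+_ (Σ≤-zero n (λ a a≤n → f≡0 a (ℕ.m≤n⇒m≤1+n a≤n))) (f≡0 (suc n) ℕ.≤-refl)

  Σ≤-+ : ∀ n f g → Σ≤ n (λ a → f a + g a) ≡ Σ≤ n f + Σ≤ n g
  Σ≤-+ zero f g = refl
  Σ≤-+ (suc n) f g = trans (cong (_+ (f (suc n) + g (suc n))) (Σ≤-+ n f g)) (interchange (Σ≤ n f) (Σ≤ n g) (f (suc n)) (g (suc n)))
    where
    interchange : ∀ a b x y → a + b + (x + y) ≡ a + x + (b + y)
    interchange = solve-∀

  Σ≤-*ˡ : ∀ n c f → Σ≤ n (λ a → c * f a) ≡ c * Σ≤ n f
  Σ≤-*ˡ zero c f = refl
  Σ≤-*ˡ (suc n) c f = trans (cong (_+ c * f (suc n)) (Σ≤-*ˡ n c f)) (sym (*-distribˡ-+ c (Σ≤ n f) (f (suc n))))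

  *₁-distribʳ-+ : ∀ (F G H : Ser₁) n → ((λ a → F a + G a) *₁ H) n ≡ (F *₁ H) n + (G *₁ H) n
  *₁-distribʳ-+ F G H n = trans (Σ≤-cong n λ a _ → distrib (F a) (G a) (H (n ℕ.∸ a))) (Σ≤-+ n _ _)
    where
    distrib : ∀ x y z → (x + y) * z ≡ x * z + y * z
    distrib = solve-∀

  *₁-suc : ∀ (F G : Ser₁) n → (F *₁ G) (suc n) ≡ F 0 * G (suc n) + ((F ∘ suc) *₁ G) n
  *₁-suc F G n = Σ≤-shift n (λ a → F a * G (suc n ℕ.∸ a))

  square-extremes : ∀ (F : Ser₁) n → (F *₁ F) (suc (suc n)) ≡
    F 0 * F (suc (suc n)) + (Σ≤ n (λ a → F (suc a) * F (suc n ℕ.∸ a)) + F (suc (suc n)) * F 0)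
  square-extremes F n = trans (Σ≤-shift (suc n) (λ a → F a * F (suc (suc n) ℕ.∸ a)))
    (cong (λ m → F 0 * F (suc (suc n)) + (Σ≤ n (λ a → F (suc a) * F (suc n ℕ.∸ a)) + F (suc (suc n)) * F m))
      (ℕ.n∸n≡0 n))

module Motzkin where

  open import Data.Nat as ℕ using (ℕ; zero; suc)
  open import Data.Integer using (ℤ; +_; _+_; _*_; 0ℤ)
  open import Data.Integer.Properties using (pos-+; *-identityˡ; +-identityˡ; +-identityʳ)
  open import Data.Integer.Tactic.RingSolver using (solve-∀)
  open import Relation.Binary.PropositionalEquality
  open import Defs using (countC; K; Ser₁; _*₁_)
  open Recurrence using (recurrence; countC-0)
  open Series

  K-0 : ∀ n → K n 0 ≡ 0ℤ
  K-0 zero = refl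
  K-0 (suc n) = cong +_ (countC-0 (suc n))

  K-recurrence : ∀ L j₀ → K (suc (suc L)) (suc j₀) ≡
    K (suc L) j₀ + K (suc L) (suc j₀) + K (suc L) (suc (suc j₀))
  K-recurrence L j₀ = trans (cong +_ (recurrence L j₀))
    (trans (pos-+ (countC (suc L) j₀ ℕ.+ countC (suc L) (suc j₀)) _)
      (cong (_+ K (suc L) (suc (suc j₀))) (pos-+ (countC (suc L) j₀) _)))

  -- The j-th column of K, without its vanishing constant term.
  column : ℕ → Ser₁
  column j a = K (suc a) j

  motzkin : Ser₁
  motzkin = column 1

  first-return : ∀ n j → K (suc (suc n)) (suc (suc j)) ≡ (column (suc j) *₁ motzkin) n
  first-return zero zero = refl
  first-return zero (suc j) = refl
  first-return (suc n) j = begin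
    K (suc (suc (suc n))) (suc (suc j))
      ≡⟨ K-recurrence (suc n) (suc j) ⟩
    K (suc (suc n)) (suc j) + K (suc (suc n)) (suc (suc j)) + K (suc (suc n)) (suc (suc (suc j)))
      ≡⟨ cong₂ _+_ (cong₂ _+_ (previous-column j) (first-return n j)) (first-return n (suc j)) ⟩
    column (suc j) 0 * motzkin (suc n) + C j + C (suc j) + C (suc (suc j))
      ≡⟨ reassociate (column (suc j) 0 * motzkin (suc n)) (C j) (C (suc j)) (C (suc (suc j))) ⟩
    column (suc j) 0 * motzkin (suc n) + (C j + C (suc j) + C (suc (suc j)))
      ≡⟨ cong (_+_ (column (suc j) 0 * motzkin (suc n))) (sym shifted-column) ⟩
    column (suc j) 0 * motzkin (suc n) + ((λ a → column (suc j) (suc a)) *₁ motzkin) n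
      ≡⟨ sym (*₁-suc (column (suc j)) motzkin n) ⟩
    (column (suc j) *₁ motzkin) (suc n) ∎
    where
    open ≡-Reasoning
    C : ℕ → ℤ
    C i = (column i *₁ motzkin) n
    reassociate : ∀ a b c d → a + b + c + d ≡ a + (b + c + d)
    reassociate = solve-∀
    -- the term of K_{n+2,j+1} not covered by the induction hypothesis
    previous-column : ∀ j → K (suc (suc n)) (suc j) ≡ column (suc j) 0 * motzkin (suc n) + C j
    previous-column zero = sym (trans
      (cong₂ _+_ (*-identityˡ (motzkin (suc n))) (Σ≤-zero n (λ a _ → cong (_* motzkin (n ℕ.∸ a)) (K-0 (suc a)))))
      (+-identityʳ (motzkin (suc n))))
    previous-column (suc j) = trans (first-return n j) (sym (+-identityˡ (C (suc j))))
    shifted-column : ((λ a → column (suc j) (suc a)) *₁ motzkin) n ≡ C j + C (suc j) + C (suc (suc j))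
    shifted-column = begin
      ((λ a → column (suc j) (suc a)) *₁ motzkin) n
        ≡⟨ Σ≤-cong n (λ a _ → cong (_* motzkin (n ℕ.∸ a)) (K-recurrence a j)) ⟩
      ((λ a → column j a + column (suc j) a + column (suc (suc j)) a) *₁ motzkin) n
        ≡⟨ *₁-distribʳ-+ (λ a → column j a + column (suc j) a) (column (suc (suc j))) motzkin n ⟩
      ((λ a → column j a + column (suc j) a) *₁ motzkin) n + C (suc (suc j))
        ≡⟨ cong (_+ C (suc (suc j))) (*₁-distribʳ-+ (column j) (column (suc j)) motzkin n) ⟩
      C j + C (suc j) + C (suc (suc j)) ∎

  motzkin-recurrence : ∀ m → motzkin (suc (suc m)) ≡ motzkin (suc m) + (motzkin *₁ motzkin) m
  motzkin-recurrence m = trans (K-recurrence (suc m) 0)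
    (cong₂ _+_ (cong (_+ motzkin (suc m)) (K-0 (suc (suc m)))) (first-return m 0))

module SquareRoot where

  open import Data.Nat as ℕ using (ℕ; zero; suc; _≤_; s≤s)
  import Data.Nat.Properties as ℕ
  open import Data.Integer using (ℤ; +_; -_; _+_; _*_)
  open import Data.Integer.Properties using (*-cancelˡ-≡; +-0-abelianGroup)
  open import Algebra.Properties.AbelianGroup +-0-abelianGroup using (∙-cancelˡ)
  open import Data.Integer.Tactic.RingSolver using (solve-∀)
  open import Data.Sum using (inj₁; inj₂)
  open import Relation.Binary.PropositionalEquality
  open import Defs using (Ser₁; _*₁_; Σ≤; disc)
  open Series
  open Motzkin using (motzkin; motzkin-recurrence)

  root : Ser₁
  root 0 = + 1
  root 1 = - + 1
  root (suc (suc m)) = - (+ 2 * motzkin m)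

  root-middle : ∀ k → Σ≤ k (λ a → root (suc (suc a)) * root (suc (suc k) ℕ.∸ a)) ≡ + 4 * (motzkin *₁ motzkin) k
  root-middle k = trans (Σ≤-cong k term) (Σ≤-*ˡ k (+ 4) _)
    where
    four : ∀ x y → - (+ 2 * x) * - (+ 2 * y) ≡ + 4 * (x * y)
    four = solve-∀
    term : ∀ a → a ≤ k → root (suc (suc a)) * root (suc (suc k) ℕ.∸ a) ≡ + 4 * (motzkin a * motzkin (k ℕ.∸ a))
    term a a≤k rewrite ℕ.+-∸-assoc 2 a≤k = four (motzkin a) (motzkin (k ℕ.∸ a))

  root-squared : ∀ n → (root *₁ root) n ≡ disc n
  root-squared 0 = refl
  root-squared 1 = refl
  root-squared 2 = refl
  root-squared 3 = refl
  root-squared (suc (suc (suc (suc k)))) = begin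
    (root *₁ root) (4 ℕ.+ k)
      ≡⟨ square-extremes root (suc (suc k)) ⟩
    root 0 * root (4 ℕ.+ k) + (Σ≤ (suc (suc k)) middle + root (4 ℕ.+ k) * root 0)
      ≡⟨ cong (λ s → root 0 * root (4 ℕ.+ k) + (s + root (4 ℕ.+ k) * root 0)) (Σ≤-shift (suc k) middle) ⟩
    root 0 * root (4 ℕ.+ k) + ((root 1 * root (3 ℕ.+ k) + (Σ≤ k (λ a → middle (suc a))
      + root (3 ℕ.+ k) * root (suc k ℕ.∸ k))) + root (4 ℕ.+ k) * root 0)
      ≡⟨ cong₂ (λ s i → root 0 * root (4 ℕ.+ k) + ((root 1 * root (3 ℕ.+ k) + (s + root (3 ℕ.+ k) * root i))
            + root (4 ℕ.+ k) * root 0)) (root-middle k) (ℕ.m+n∸n≡m 1 k) ⟩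
    root 0 * root (4 ℕ.+ k) + ((root 1 * root (3 ℕ.+ k) + (+ 4 * C + root (3 ℕ.+ k) * root 1))
      + root (4 ℕ.+ k) * root 0)
      ≡⟨ cong (λ x → root 0 * x + ((root 1 * root (3 ℕ.+ k) + (+ 4 * C + root (3 ℕ.+ k) * root 1)) + x * root 0))
           (cong (λ x → - (+ 2 * x)) (motzkin-recurrence k)) ⟩
    + 1 * - (+ 2 * (M + C)) + ((- + 1 * - (+ 2 * M) + (+ 4 * C + - (+ 2 * M) * - + 1))
      + - (+ 2 * (M + C)) * + 1)
      ≡⟨ cancels M C ⟩
    disc (4 ℕ.+ k) ∎
    where
    open ≡-Reasoning
    middle : ℕ → ℤ
    middle a = root (suc a) * root (suc (suc (suc k)) ℕ.∸ a)
    M C : ℤ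
    M = motzkin (suc k)
    C = (motzkin *₁ motzkin) k
    cancels : ∀ M C → + 1 * - (+ 2 * (M + C)) + ((- + 1 * - (+ 2 * M) + (+ 4 * C + - (+ 2 * M) * - + 1))
      + - (+ 2 * (M + C)) * + 1) ≡ + 0
    cancels = solve-∀

  square-root-unique : (S T : Ser₁) → S 0 ≡ + 1 → T 0 ≡ + 1 →
    (∀ n → (S *₁ S) n ≡ (T *₁ T) n) → ∀ n → S n ≡ T n
  square-root-unique S T S₀ T₀ S²≡T² n = agree-upTo n n ℕ.≤-refl
    where
    open ≡-Reasoning
    double : ∀ x → + 1 * x + x * + 1 ≡ + 2 * x
    double = solve-∀
    double-plus : ∀ x r → + 1 * x + (r + x * + 1) ≡ r + + 2 * x
    double-plus = solve-∀
    -- the coefficient of t^{n+1} in S² is 2S_{n+1} plus terms in S₁, …, S_n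
    next : ∀ n → (∀ m → m ≤ n → S m ≡ T m) → S (suc n) ≡ T (suc n)
    next zero _ = *-cancelˡ-≡ (+ 2) (S 1) (T 1) (begin
      + 2 * S 1                ≡⟨ sym (double (S 1)) ⟩
      + 1 * S 1 + S 1 * + 1    ≡⟨ cong (λ s → s * S 1 + S 1 * s) (sym S₀) ⟩
      (S *₁ S) 1               ≡⟨ S²≡T² 1 ⟩
      (T *₁ T) 1               ≡⟨ cong (λ t → t * T 1 + T 1 * t) T₀ ⟩
      + 1 * T 1 + T 1 * + 1    ≡⟨ double (T 1) ⟩
      + 2 * T 1                ∎)
    next (suc n) agree = *-cancelˡ-≡ (+ 2) (S (suc (suc n))) (T (suc (suc n))) (∙-cancelˡ R _ _ (begin
      R + + 2 * S (suc (suc n))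
        ≡⟨ sym (double-plus (S (suc (suc n))) R) ⟩
      + 1 * S (suc (suc n)) + (R + S (suc (suc n)) * + 1)
        ≡⟨ cong₂ (λ s r → s * S (suc (suc n)) + (r + S (suc (suc n)) * s)) (sym S₀) (sym middle) ⟩
      S 0 * S (suc (suc n)) + (Σ≤ n (λ a → S (suc a) * S (suc n ℕ.∸ a)) + S (suc (suc n)) * S 0)
        ≡⟨ sym (square-extremes S n) ⟩
      (S *₁ S) (suc (suc n))
        ≡⟨ S²≡T² (suc (suc n)) ⟩
      (T *₁ T) (suc (suc n))
        ≡⟨ square-extremes T n ⟩
      T 0 * T (suc (suc n)) + (R + T (suc (suc n)) * T 0)
        ≡⟨ cong (λ t → t * T (suc (suc n)) + (R + T (suc (suc n)) * t)) T₀ ⟩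
      + 1 * T (suc (suc n)) + (R + T (suc (suc n)) * + 1)
        ≡⟨ double-plus (T (suc (suc n))) R ⟩
      R + + 2 * T (suc (suc n)) ∎))
      where
      R = Σ≤ n (λ a → T (suc a) * T (suc n ℕ.∸ a))
      middle : Σ≤ n (λ a → S (suc a) * S (suc n ℕ.∸ a)) ≡ R
      middle = Σ≤-cong n λ a a≤n → cong₂ _*_ (agree (suc a) (s≤s a≤n)) (agree (suc n ℕ.∸ a) (ℕ.m∸n≤m (suc n) a))
    agree-upTo : ∀ n m → m ≤ n → S m ≡ T m
    agree-upTo zero zero _ = trans S₀ (sym T₀)
    agree-upTo (suc n) m m≤n+1 with ℕ.m≤n⇒m<n∨m≡n m≤n+1
    ... | inj₁ m<n+1 = agree-upTo n m (ℕ.≤-pred m<n+1)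
    ... | inj₂ refl = next n (agree-upTo n)

  sqrt-disc-unique : (S : Ser₁) → S 0 ≡ + 1 → (∀ n → (S *₁ S) n ≡ disc n) → ∀ n → S n ≡ root n
  sqrt-disc-unique S S₀ S² = square-root-unique S root S₀ refl (λ n → trans (S² n) (sym (root-squared n)))

module Coefficients where

  open import Data.Nat as ℕ using (ℕ; zero; suc)
  import Data.Nat.Properties as ℕ
  open import Data.Integer using (ℤ; +_; -_; _+_; _-_; _*_; 0ℤ)
  open import Data.Integer.Properties using (*-zeroʳ; +-identityˡ)
  open import Data.Integer.Tactic.RingSolver using (solve-∀)
  open import Relation.Binary.PropositionalEquality
  open import Defs using (Ser₁; Ser₂; _*₂_; Σ≤; K; Du; Nu)
  open Series
  open Motzkin using (K-0; K-recurrence; motzkin)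
  open SquareRoot using (root)

  u· : (ℕ → ℤ) → ℕ → ℤ
  u· F zero = 0ℤ
  u· F (suc k) = F k

  -- Du has t-degree ≤ 1, so row N + 1 of G·Du only involves rows N and N + 1 of G.
  rows-of-·Du : ∀ (G : Ser₂) N k → (G *₂ Du) (suc N) k ≡
    Σ≤ k (λ b → G N b * Du 1 (k ℕ.∸ b)) + Σ≤ k (λ b → G (suc N) b * Du 0 (k ℕ.∸ b))
  rows-of-·Du G zero k = refl
  rows-of-·Du G (suc N) k = begin
    Σ≤ N row + row (suc N) + row (suc (suc N))
      ≡⟨ cong₂ (λ s d → s + row (suc N) + Σ≤ k (λ b → G (suc (suc N)) b * Du d (k ℕ.∸ b)))
           (Σ≤-zero N λ a a≤N → Σ≤-zero k λ b _ →
             trans (cong (λ d → G a b * Du d (k ℕ.∸ b)) (ℕ.+-∸-assoc 2 a≤N)) (*-zeroʳ (G a b)))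
           (ℕ.n∸n≡0 N) ⟩
    0ℤ + row (suc N) + Σ≤ k (λ b → G (suc (suc N)) b * Du 0 (k ℕ.∸ b))
      ≡⟨ cong (λ d → 0ℤ + Σ≤ k (λ b → G (suc N) b * Du d (k ℕ.∸ b)) + Σ≤ k (λ b → G (suc (suc N)) b * Du 0 (k ℕ.∸ b)))
           (ℕ.m+n∸n≡m 1 N) ⟩
    0ℤ + Σ≤ k (λ b → G (suc N) b * Du 1 (k ℕ.∸ b)) + Σ≤ k (λ b → G (suc (suc N)) b * Du 0 (k ℕ.∸ b))
      ≡⟨ cong (_+ Σ≤ k (λ b → G (suc (suc N)) b * Du 0 (k ℕ.∸ b))) (+-identityˡ (Σ≤ k (λ b → G (suc N) b * Du 1 (k ℕ.∸ b)))) ⟩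
    Σ≤ k (λ b → G (suc N) b * Du 1 (k ℕ.∸ b)) + Σ≤ k (λ b → G (suc (suc N)) b * Du 0 (k ℕ.∸ b)) ∎
    where
    open ≡-Reasoning
    row : ℕ → ℤ
    row a = Σ≤ k (λ b → G a b * Du (suc (suc N) ℕ.∸ a) (k ℕ.∸ b))

  Σ≤-last-three : ∀ m (F D : ℕ → ℤ) → (∀ i → D (3 ℕ.+ i) ≡ 0ℤ) →
    Σ≤ (3 ℕ.+ m) (λ b → F b * D (3 ℕ.+ m ℕ.∸ b)) ≡ F (1 ℕ.+ m) * D 2 + F (2 ℕ.+ m) * D 1 + F (3 ℕ.+ m) * D 0
  Σ≤-last-three m F D D₃ = begin
    Σ≤ m term + F (1 ℕ.+ m) * D (2 ℕ.+ m ℕ.∸ m) + F (2 ℕ.+ m) * D (1 ℕ.+ m ℕ.∸ m) + F (3 ℕ.+ m) * D (m ℕ.∸ m)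
      ≡⟨ cong₂ (λ s i → s + F (1 ℕ.+ m) * D i + F (2 ℕ.+ m) * D (1 ℕ.+ m ℕ.∸ m) + F (3 ℕ.+ m) * D (m ℕ.∸ m))
           (Σ≤-zero m λ b b≤m → trans (cong (λ d → F b * D d) (ℕ.+-∸-assoc 3 b≤m))
                                     (trans (cong (F b *_) (D₃ (m ℕ.∸ b))) (*-zeroʳ (F b))))
           (ℕ.m+n∸n≡m 2 m) ⟩
    0ℤ + F (1 ℕ.+ m) * D 2 + F (2 ℕ.+ m) * D (1 ℕ.+ m ℕ.∸ m) + F (3 ℕ.+ m) * D (m ℕ.∸ m)
      ≡⟨ cong₂ (λ i j → 0ℤ + F (1 ℕ.+ m) * D 2 + F (2 ℕ.+ m) * D i + F (3 ℕ.+ m) * D j)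
           (ℕ.m+n∸n≡m 1 m) (ℕ.n∸n≡0 m) ⟩
    0ℤ + F (1 ℕ.+ m) * D 2 + F (2 ℕ.+ m) * D 1 + F (3 ℕ.+ m) * D 0
      ≡⟨ cong (λ x → x + F (2 ℕ.+ m) * D 1 + F (3 ℕ.+ m) * D 0) (+-identityˡ (F (1 ℕ.+ m) * D 2)) ⟩
    F (1 ℕ.+ m) * D 2 + F (2 ℕ.+ m) * D 1 + F (3 ℕ.+ m) * D 0 ∎
    where
    open ≡-Reasoning
    term : ℕ → ℤ
    term b = F b * D (3 ℕ.+ m ℕ.∸ b)

  twice-three : ∀ a b c → a * + 2 + b * + 2 + c * + 2 ≡ + 2 * (c + b + a)
  twice-three = solve-∀

  minus-twice-middle : ∀ a b c → a * 0ℤ + b * - + 2 + c * 0ℤ ≡ - (+ 2 * b)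
  minus-twice-middle = solve-∀

  -- Row 1 of Du is 2 + 2u + 2u².
  ·Du-row1 : ∀ F k → Σ≤ k (λ b → F b * Du 1 (k ℕ.∸ b)) ≡ + 2 * (F k + u· F k + u· (u· F) k)
  ·Du-row1 F 0 = lemma (F 0)
    where
    lemma : ∀ a → a * + 2 ≡ + 2 * (a + 0ℤ + 0ℤ)
    lemma = solve-∀
  ·Du-row1 F 1 = lemma (F 0) (F 1)
    where
    lemma : ∀ a b → a * + 2 + b * + 2 ≡ + 2 * (b + a + 0ℤ)
    lemma = solve-∀
  ·Du-row1 F 2 = twice-three (F 0) (F 1) (F 2)
  ·Du-row1 F (suc (suc (suc m))) =
    trans (Σ≤-last-three m F (Du 1) (λ _ → refl)) (twice-three (F (1 ℕ.+ m)) (F (2 ℕ.+ m)) (F (3 ℕ.+ m)))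

  -- Row 0 of Du is -2u.
  ·Du-row0 : ∀ F k → Σ≤ k (λ b → F b * Du 0 (k ℕ.∸ b)) ≡ - (+ 2 * u· F k)
  ·Du-row0 F 0 = *-zeroʳ (F 0)
  ·Du-row0 F 1 = lemma (F 0) (F 1)
    where
    lemma : ∀ a b → a * - + 2 + b * 0ℤ ≡ - (+ 2 * a)
    lemma = solve-∀
  ·Du-row0 F 2 = minus-twice-middle (F 0) (F 1) (F 2)
  ·Du-row0 F (suc (suc (suc m))) =
    trans (Σ≤-last-three m F (Du 0) (λ _ → refl)) (minus-twice-middle (F (1 ℕ.+ m)) (F (2 ℕ.+ m)) (F (3 ℕ.+ m)))

  K·Du-row : ∀ N k → (K *₂ Du) (suc N) k ≡
    + 2 * (K N k + u· (K N) k + u· (u· (K N)) k) - + 2 * u· (K (suc N)) k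
  K·Du-row N k = trans (rows-of-·Du K N k) (cong₂ _+_ (·Du-row1 (K N) k) (·Du-row0 (K (suc N)) k))


  -- The coefficients of Nu root: the recurrence (rows N ≥ 1, u-degree ≥ 2), the
  -- vanishing first column (u-degree 0), the Motzkin column against root (u-degree 1)
  -- and the first row of K (N = 0).
  K·Du-row≡Nu : ∀ N k → + 2 * (K N k + u· (K N) k + u· (u· (K N)) k) - + 2 * u· (K (suc N)) k ≡ Nu root (suc N) k
  K·Du-row≡Nu N 0 = cong (λ x → + 2 * (x + 0ℤ + 0ℤ) - + 2 * 0ℤ) (K-0 N)
  K·Du-row≡Nu 0 1 = refl
  K·Du-row≡Nu (suc N) 1 =
    trans (cong₂ (λ x y → + 2 * (motzkin N + x + 0ℤ) - + 2 * y) (K-0 (suc N)) (K-0 (suc (suc N)))) (lemma (motzkin N))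
    where
    lemma : ∀ m → + 2 * (m + 0ℤ + 0ℤ) - + 2 * 0ℤ ≡ (0ℤ + - 0ℤ) + - - (+ 2 * m)
    lemma = solve-∀
  K·Du-row≡Nu 0 2 = refl
  K·Du-row≡Nu 0 (suc (suc (suc j))) = refl
  K·Du-row≡Nu (suc N) (suc (suc j₀)) =
    trans (cong (λ x → + 2 * (K (suc N) (suc (suc j₀)) + K (suc N) (suc j₀) + K (suc N) j₀) - + 2 * x)
      (K-recurrence N j₀)) (lemma (K (suc N) j₀) (K (suc N) (suc j₀)) (K (suc N) (suc (suc j₀))))
    where
    lemma : ∀ a b c → + 2 * (c + b + a) - + 2 * (a + b + c) ≡ 0ℤ
    lemma = solve-∀

  K·Du≡Nu-root : ∀ n k → (K *₂ Du) n k ≡ Nu root n k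
  K·Du≡Nu-root zero k = trans (Σ≤-zero k (λ _ _ → refl)) (Nu-root-0 k)
    where
    Nu-root-0 : ∀ k → 0ℤ ≡ Nu root 0 k
    Nu-root-0 0 = refl
    Nu-root-0 1 = refl
    Nu-root-0 (suc (suc k)) = refl
  K·Du≡Nu-root (suc N) k = trans (K·Du-row N k) (K·Du-row≡Nu N k)

  Nu-cong : ∀ {S T : Ser₁} → (∀ n → S n ≡ T n) → ∀ n k → Nu S n k ≡ Nu T n k
  Nu-cong S≡T n 0 = refl
  Nu-cong S≡T 0 1 = cong (λ x → + 1 + - 0ℤ + - x) (S≡T 0)
  Nu-cong S≡T 1 1 = cong (λ x → 0ℤ + - + 1 + - x) (S≡T 1)
  Nu-cong S≡T (suc (suc n)) 1 = cong (λ x → 0ℤ + - 0ℤ + - x) (S≡T (suc (suc n)))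
  Nu-cong S≡T 0 (suc (suc k)) = refl
  Nu-cong S≡T 1 2 = refl
  Nu-cong S≡T 1 (suc (suc (suc k))) = refl
  Nu-cong S≡T (suc (suc n)) (suc (suc k)) = refl

open import Data.Nat using (ℕ)
open import Data.Integer using (ℤ; +_)
open import Relation.Binary.PropositionalEquality using (_≡_; sym; module ≡-Reasoning)
open import Defs
open SquareRoot using (root; sqrt-disc-unique)
open Coefficients using (K·Du≡Nu-root; Nu-cong)

proposition2p4 : (S : Ser₁) → S 0 ≡ + 1 → (∀ n → (S *₁ S) n ≡ disc n) →
    ∀ n k → (K *₂ Du) n k ≡ Nu S n k
proposition2p4 S S₀ S² n k = begin
  (K *₂ Du) n k  ≡⟨ K·Du≡Nu-root n k ⟩
  Nu root n k    ≡⟨ Nu-cong (λ m → sym (sqrt-disc-unique S S₀ S² m)) n k ⟩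
  Nu S n k       ∎
  where open ≡-Reasoning
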